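{- For all $r\ge1$, $$\tilde{\mathfrak b}[X_1,\dots,X_r\mid Y_1,\dots,Y_r]=\tilde{\mathfrak b}[-Y_1-\dots-Y_r,\,-Y_1-\dots-Y_{r-1},\dots,-Y_1-Y_2,\,-Y_1\mid -X_r,\,-X_{r-1}+X_r,\dots,-X_2+X_3,\,-X_1+X_2].$$
   Context: Fixed mould $\beta$: $\beta^{(0)}=1$, $\beta(X_1,\dots,X_r)=\sum_{k_i\ge1}\beta(k_1,\dots,k_r)X_1^{k_1-1}\cdots X_r^{k_r-1}\in\mathbb{Q}[[X_1,\dots,X_r]]$, with: (i) $\beta(X)=-\sum_{k\ge2}\frac{B_k}{2\,k!}X^{k-1}$ ($B_k$ Bernoulli numbers); (ii) $z_{k_1}\cdots z_{k_r}\mapsto\beta(k_1,\dots,k_r)$ is an algebra homomorphism from $\mathbb{Q}\langle z_1,z_2,\dots\rangle$ with the stuffle product to $\mathbb{Q}$; (iii) with $\sum_j\gamma_jT^j=\exp(\sum_{n\ge2}\frac{(-1)^n}{n}\beta(n)T^n)$ and $\beta_\gamma(X_1,\dots,X_r)=\sum_{j=0}^r\gamma_j\beta(X_1+\dots+X_{r-j},\dots,X_1+X_2,X_1)$, the map sending $z_{k_1}\cdots z_{k_r}$ to the coefficient of $X_1^{k_1-1}\cdots X_r^{k_r-1}$ in $\beta_\gamma$ is an algebra homomorphism for the shuffle product. (Quasi-shuffle product for commutative associative $\diamond$: $\mathbf 1\ast w=w\ast\mathbf 1=w$, $aw\ast bv=a(w\ast bv)+b(aw\ast v)+(a\diamond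 b)(w\ast v)$; stuffle: $z_i\diamond z_j=z_{i+j}$; shuffle: $z_i\diamond z_j=0$.) Bimoulds $\mathfrak b,\tilde{\mathfrak b}$ (families of power series in $X_1,\dots,X_r,Y_1,\dots,Y_r$, depth-0 part $1$): $\mathfrak b[X_1,\dots,X_r\mid Y_1,\dots,Y_r]=\sum_{0\le i\le j\le r}\gamma_i\beta(Y_1+\dots+Y_{j-i},\dots,Y_1+Y_2,Y_1)\beta(X_{j+1},\dots,X_r)$ and $\tilde{\mathfrak b}[X_1,\dots,X_r\mid Y_1,\dots,Y_r]=\sum_{i=0}^r\frac{(-1)^i}{2^ii!}\mathfrak b[X_{i+1},\dots,X_r\mid-Y_1,\dots,-Y_{r-i}]$. -}

module Defs where

open import Data.Nat using (ℕ; zero; suc; _≡ᵇ_; _<ᵇ_; _≤ᵇ_; _!; _∸_; _^_)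
import Data.Nat as ℕ
open import Data.Nat.Combinatorics using (_C_)
open import Data.Integer using (+_)
open import Data.Rational using (ℚ; 0ℚ; 1ℚ; _+_; _*_; -_; _/_)
open import Data.List using (List; []; _∷_; map; _++_; foldr; concatMap; upTo; length; reverse; zip; allFin)
open import Data.Vec using (Vec; []; _∷_; toList; fromList; lookup; tabulate; zipWith)
import Data.Vec as Vec
open import Data.Fin using (Fin; toℕ)
open import Data.Bool using (Bool; true; false; if_then_else_; _∧_)
open import Data.Maybe using (Maybe; just; nothing)
open import Data.Product using (_×_; _,_)
open import Relation.Binary.PropositionalEquality using (_≡_)

sumOver : {A : Set} → List A → (A → ℚ) → ℚ
sumOver xs f = foldr (λ x acc → f x + acc) 0ℚ xs

fromℕℚ : ℕ → ℚ
fromℕℚ n = (+ n) / 1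

-- recip n = 1/n  (recip 0 = 0; only used at nonzero arguments)
recip : ℕ → ℚ
recip zero    = 0ℚ
recip (suc n) = (+ 1) / suc n

sign : ℕ → ℚ
sign zero    = 1ℚ
sign (suc n) = - sign n

-- Bernoulli numbers: B_0 = 1, B_m = -1/(m+1) Σ_{j<m} C(m+1,j) B_j

-- bernRev n = B_n ∷ B_{n-1} ∷ … ∷ B_0
bernRev : ℕ → List ℚ
bernRev zero    = 1ℚ ∷ []
bernRev (suc n) = nextB ∷ l
  where
  l : List ℚ
  l = bernRev n
  nextB : ℚ
  nextB = - (recip (suc (suc n)) *
             sumOver (zip (upTo (suc n)) (reverse l))
                     (λ { (j , b) → fromℕℚ (suc (suc n) C j) * b }))

headOr0 : List ℚ → ℚ
headOr0 []      = 0ℚ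
headOr0 (x ∷ _) = x

bern : ℕ → ℚ
bern n = headOr0 (bernRev n)

-- Formal power series in n commuting variables over ℚ,
-- given by their coefficient function on exponent vectors.

Series : ℕ → Set
Series n = Vec ℕ n → ℚ

box : ∀ {n} → Vec ℕ n → List (Vec ℕ n)
box []       = [] ∷ []
box (b ∷ bs) = concatMap (λ a → map (a ∷_) (box bs)) (upTo (suc b))

comps : (m d : ℕ) → List (Vec ℕ m)
comps zero    zero    = [] ∷ []
comps zero    (suc d) = []
comps (suc m) d       = concatMap (λ a → map (a ∷_) (comps m (d ∸ a))) (upTo (suc d))

eqVec : ∀ {n} → Vec ℕ n → Vec ℕ n → Bool
eqVec []       []       = true
eqVec (x ∷ xs) (y ∷ ys) = (x ≡ᵇ y) ∧ eqVec xs ys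

zeroVec : ∀ {n} → Vec ℕ n
zeroVec = tabulate (λ _ → 0)

unitVec : ∀ {n} → Fin n → Vec ℕ n
unitVec j = tabulate (λ i → if toℕ i ≡ᵇ toℕ j then 1 else 0)

oneS : ∀ {n} → Series n
oneS e = if eqVec e zeroVec then 1ℚ else 0ℚ

_⊗_ : ∀ {n} → Series n → Series n → Series n
(P ⊗ Q) b = sumOver (box b) (λ a → P a * Q (zipWith _∸_ b a))

powS : ∀ {n} → Series n → ℕ → Series n
powS P zero    = oneS
powS P (suc k) = P ⊗ powS P k

linForm : ∀ {n} → (Fin n → ℚ) → Series n
linForm {n} c e = sumOver (allFin n) (λ j → if eqVec e (unitVec j) then c j else 0ℚ)

monoSub : ∀ {m n} → (Fin m → Fin n → ℚ) → Vec ℕ m → Series n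
monoSub {m} M a = foldr (λ i acc → powS (linForm (M i)) (lookup a i) ⊗ acc) oneS (allFin m)

-- linear substitution: (linSubst P M)(Y) = P(X_1 := Σ_j M 1 j Y_j, …, X_m := Σ_j M m j Y_j)
-- (well defined since the substituted forms are homogeneous of degree 1)
linSubst : ∀ {m n} → Series m → (Fin m → Fin n → ℚ) → Series n
linSubst {m} P M b = sumOver (comps m (Vec.sum b)) (λ a → P a * monoSub M a b)

-- A word z_{k_1}…z_{k_r} (k_i ≥ 1) is encoded
-- as the list (k_1 - 1) ∷ … ∷ (k_r - 1), i.e. the letter n stands for z_{n+1}.
-- A quasi-shuffle product of words is returned as the list of words in the
-- resulting formal sum (all coefficients are 1 for stuffle and shuffle).

diamondPart : Maybe ℕ → List (List ℕ) → List (List ℕ)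
diamondPart nothing  ws = []
diamondPart (just c) ws = map (c ∷_) ws

qsh : (ℕ → ℕ → Maybe ℕ) → List ℕ → List ℕ → List (List ℕ)
qsh d []       v        = v ∷ []
qsh d (a ∷ w)  []       = (a ∷ w) ∷ []
qsh d (a ∷ w)  (b ∷ v)  =
  map (a ∷_) (qsh d w (b ∷ v)) ++ map (b ∷_) (qsh d (a ∷ w) v) ++ diamondPart (d a b) (qsh d w v)

-- stuffle: z_i ⋄ z_j = z_{i+j}; in the encoding (a,b) ↦ a + b + 1
stuffle : List ℕ → List ℕ → List (List ℕ)
stuffle = qsh (λ a b → just (suc (a ℕ.+ b)))

shuffle : List ℕ → List ℕ → List (List ℕ)
shuffle = qsh (λ _ _ → nothing)

-- The mould β is given by its coefficients β(k_1,…,k_r), as a function on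
-- encoded words: β w = β(w_1+1, …, w_r+1).

Mould : Set
Mould = List ℕ → ℚ

-- β(X_1,…,X_d) = Σ β(k) X^(k-1) as a power series in d variables
βser : Mould → (d : ℕ) → Series d
βser β d a = β (toList a)

S1 : Set
S1 = ℕ → ℚ

mul1 : S1 → S1 → S1
mul1 F G j = sumOver (upTo (suc j)) (λ i → F i * G (j ∸ i))

pow1 : S1 → ℕ → S1
pow1 F zero    j = if j ≡ᵇ 0 then 1ℚ else 0ℚ
pow1 F (suc k) = mul1 F (pow1 F k)

-- F(T) = Σ_{n≥2} (-1)^n/n β(n) T^n
γarg : Mould → S1
γarg β zero          = 0ℚ
γarg β (suc zero)    = 0ℚ
γarg β (suc (suc m)) = sign (suc (suc m)) * recip (suc (suc m)) * β (suc m ∷ [])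

-- γ_j = coefficient of T^j in exp(F) = Σ_{m ≤ j} [T^j] F^m / m!   (F has no constant term)
γ : Mould → ℕ → ℚ
γ β j = sumOver (upTo (suc j)) (λ m → pow1 (γarg β) m j * recip (m !))

-- matrix for β(X_1+…+X_{r-j}, …, X_1+X_2, X_1)
Mγ : (r j : ℕ) → Fin (r ∸ j) → Fin r → ℚ
Mγ r j p l = if toℕ l <ᵇ (r ∸ j ∸ toℕ p) then 1ℚ else 0ℚ

βγser : Mould → (r : ℕ) → Series r
βγser β r e = sumOver (upTo (suc r)) (λ j → γ β j * linSubst (βser β (r ∸ j)) (Mγ r j) e)

βγ : Mould → List ℕ → ℚ
βγ β w = βγser β (length w) (fromList w)

record IsBeta (β : Mould) : Set where
  field
    depth0     : β [] ≡ 1ℚ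
    depth1-one : β (0 ∷ []) ≡ 0ℚ
    depth1     : ∀ m → β (suc m ∷ []) ≡
                   - (bern (suc (suc m)) * recip (2 ℕ.* (suc (suc m)) !))
    stuffleHom : ∀ u v → sumOver (stuffle u v) β ≡ β u * β v
    shuffleHom : ∀ u v → sumOver (shuffle u v) (βγ β) ≡ βγ β u * βγ β v

-- Bimoulds.  A depth-r bimould component is a series in 2r variables,
-- ordered X_1,…,X_r,Y_1,…,Y_r (variable index v: X_{v+1} if v < r,
-- Y_{v-r+1} otherwise).

-- β(Y_1+…+Y_{j-i}, …, Y_1+Y_2, Y_1)
MY : (r j i : ℕ) → Fin (j ∸ i) → Fin (r ℕ.+ r) → ℚ
MY r j i p v = if (r ≤ᵇ toℕ v) ∧ ((toℕ v ∸ r) <ᵇ (j ∸ i ∸ toℕ p)) then 1ℚ else 0ℚ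

-- β(X_{j+1}, …, X_r)
MX : (r j : ℕ) → Fin (r ∸ j) → Fin (r ℕ.+ r) → ℚ
MX r j p v = if toℕ v ≡ᵇ (j ℕ.+ toℕ p) then 1ℚ else 0ℚ

bb : Mould → (r : ℕ) → Series (r ℕ.+ r)
bb β r e =
  sumOver (upTo (suc r)) (λ j →
    sumOver (upTo (suc j)) (λ i →
      γ β i * (linSubst (βser β (j ∸ i)) (MY r j i) ⊗ linSubst (βser β (r ∸ j)) (MX r j)) e))

-- b[X_{i+1},…,X_r | -Y_1,…,-Y_{r-i}]
Nt : (r i : ℕ) → Fin ((r ∸ i) ℕ.+ (r ∸ i)) → Fin (r ℕ.+ r) → ℚ
Nt r i p v =
  if toℕ p <ᵇ (r ∸ i)
  then (if toℕ v ≡ᵇ (i ℕ.+ toℕ p) then 1ℚ else 0ℚ)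
  else (if toℕ v ≡ᵇ (r ℕ.+ (toℕ p ∸ (r ∸ i))) then - 1ℚ else 0ℚ)

bt : Mould → (r : ℕ) → Series (r ℕ.+ r)
bt β r e =
  sumOver (upTo (suc r)) (λ i →
    sign i * recip (2 ^ i ℕ.* i !) * linSubst (bb β (r ∸ i)) (Nt r i) e)

-- the substitution
-- X_p ↦ -Y_1-…-Y_{r-p+1},  Y_1 ↦ -X_r,  Y_q ↦ -X_{r-q+1} + X_{r-q+2} (q ≥ 2)
Sw : (r : ℕ) → Fin (r ℕ.+ r) → Fin (r ℕ.+ r) → ℚ
Sw r p v =
  if toℕ p <ᵇ r
  then (if (r ≤ᵇ toℕ v) ∧ ((toℕ v ∸ r) <ᵇ (r ∸ toℕ p)) then - 1ℚ else 0ℚ)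
  else ((if toℕ v ≡ᵇ (r ∸ 1 ∸ (toℕ p ∸ r)) then - 1ℚ else 0ℚ)
        + (if (1 ≤ᵇ (toℕ p ∸ r)) ∧ (toℕ v ≡ᵇ (r ∸ (toℕ p ∸ r))) then 1ℚ else 0ℚ))

-- Expanding 𝔟 inside b̃ gives
--   b̃[X | Y] = Σ_i c_i Σ_k γ_k Σ_{a + b = r - i - k} β(-Y₁-…-Y_a, …, -Y₁) β(X_{r-b+1}, …, X_r),
-- with c_i = (-1)^i / (2^i i!). Under the substitution X_p ↦ -Y₁-…-Y_{r-p+1}, Y_q ↦ -X_{r-q+1} + X_{r-q+2}
-- the block β(X_{r-b+1}, …, X_r) becomes β(-Y₁-…-Y_b, …, -Y₁), and since partial sums of the Y′s telescope,
-- β(-Y₁-…-Y_a, …, -Y₁) becomes β(X_{r-a+1}, …, X_r). So the substitution only exchanges a and b, and the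
-- sum is symmetric in them. As linear substitution of power series is multiplicative and compatible with
-- composition of matrices, everything reduces to four identities between substitution matrices.

module Submission where

open import Defs
open import Data.Bool using (Bool; true; false; T; if_then_else_; _∧_)
open import Data.Bool.Properties using (∧-zeroʳ)
open import Data.Empty using (⊥-elim)
open import Data.Fin using (Fin; toℕ)
import Data.Fin as F
import Data.Fin.Properties as FinP
open import Data.List using (List; []; _∷_; map; _++_; foldr; concatMap; filter; upTo; allFin)
import Data.List
import Data.List.Properties as ListP
open import Data.List.Membership.Propositional using (_∈_; _∉_)
import Data.List.Membership.Propositional.Properties as ∈P
open import Data.List.Relation.Unary.All using ([]; _∷_)
import Data.List.Relation.Unary.All as All
import Data.List.Relation.Unary.All.Properties as AllP
open import Data.List.Relation.Unary.AllPairs using ([]; _∷_)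
open import Data.List.Relation.Unary.Any using (here; there)
open import Data.List.Relation.Binary.Disjoint.Propositional using (Disjoint)
open import Data.List.Relation.Unary.Unique.Propositional using (Unique)
import Data.List.Relation.Unary.Unique.Propositional.Properties as UniqueP
open import Data.Nat using (ℕ; zero; suc; _≤_; _<_; s≤s; z≤n; _∸_; _≡ᵇ_; _<ᵇ_; _≤ᵇ_; _^_; _!)
import Data.Nat as ℕ
import Data.Nat.Properties as ℕP
import Data.Nat.Solver
open import Data.Product using (_×_; _,_; proj₁; proj₂; Σ)
import Data.Product.Properties as ProdP
open import Data.Rational using (ℚ; 0ℚ; 1ℚ; _+_; _*_; -_)
open import Data.Rational.Properties using (+-assoc; +-identityˡ; +-identityʳ; *-comm; *-assoc; *-zeroˡ; *-zeroʳ; *-identityˡ; *-identityʳ; *-distribˡ-+)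
open import Data.Rational.Solver using (module +-*-Solver)
open import Data.Sum using (_⊎_; inj₁; inj₂)
open import Data.Vec using (Vec; []; _∷_; zipWith; lookup)
import Data.Vec as Vec
import Data.Vec.Properties as VecP
open import Data.Vec.Relation.Binary.Pointwise.Inductive using (Pointwise; []; _∷_)
open import Function using (_∘_)
open import Relation.Binary.Bundles using (Setoid)
open import Relation.Binary.Definitions using (DecidableEquality)
import Relation.Binary.Reasoning.Setoid as SetoidReasoning
open import Relation.Binary.PropositionalEquality
open import Relation.Nullary using (¬_; yes; no; ¬?)

open +-*-Solver using (solve; _:+_; _:*_; _:=_)

private variable A B C : Set

sum-cong : (L : List A) {f g : A → ℚ} → (∀ x → x ∈ L → f x ≡ g x) → sumOver L f ≡ sumOver L g
sum-cong []      h = refl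
sum-cong (x ∷ L) h = cong₂ _+_ (h x (here refl)) (sum-cong L (λ y m → h y (there m)))

sum-zero : (L : List A) {f : A → ℚ} → (∀ x → x ∈ L → f x ≡ 0ℚ) → sumOver L f ≡ 0ℚ
sum-zero L h = trans (sum-cong L h) (sum-const0 L)
  where
  sum-const0 : (L : List A) → sumOver L (λ _ → 0ℚ) ≡ 0ℚ
  sum-const0 []      = refl
  sum-const0 (_ ∷ L) = trans (+-identityˡ _) (sum-const0 L)

sum-+ : (L : List A) (f g : A → ℚ) → sumOver L (λ x → f x + g x) ≡ sumOver L f + sumOver L g
sum-+ []      f g = sym (+-identityˡ 0ℚ)
sum-+ (x ∷ L) f g = trans (cong ((f x + g x) +_) (sum-+ L f g))
  (solve 4 (λ a b c d → (a :+ b) :+ (c :+ d) := (a :+ c) :+ (b :+ d)) refl (f x) (g x) (sumOver L f) (sumOver L g))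

*-distribˡ-sum : (L : List A) (c : ℚ) (f : A → ℚ) → c * sumOver L f ≡ sumOver L (λ x → c * f x)
*-distribˡ-sum []      c f = *-zeroʳ c
*-distribˡ-sum (x ∷ L) c f = trans (*-distribˡ-+ c (f x) (sumOver L f)) (cong ((c * f x) +_) (*-distribˡ-sum L c f))

*-distribʳ-sum : (L : List A) (c : ℚ) (f : A → ℚ) → sumOver L f * c ≡ sumOver L (λ x → f x * c)
*-distribʳ-sum L c f = trans (*-comm _ c) (trans (*-distribˡ-sum L c f) (sum-cong L (λ x _ → *-comm c (f x))))

sum-++ : (L K : List A) (f : A → ℚ) → sumOver (L ++ K) f ≡ sumOver L f + sumOver K f
sum-++ []      K f = sym (+-identityˡ _)
sum-++ (x ∷ L) K f = trans (cong (f x +_) (sum-++ L K f)) (sym (+-assoc (f x) _ _))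

sum-map : (L : List A) (g : A → B) (f : B → ℚ) → sumOver (map g L) f ≡ sumOver L (f ∘ g)
sum-map []      g f = refl
sum-map (x ∷ L) g f = cong (f (g x) +_) (sum-map L g f)

sum-concatMap : (L : List A) (g : A → List B) (f : B → ℚ) →
  sumOver (concatMap g L) f ≡ sumOver L (λ x → sumOver (g x) f)
sum-concatMap []      g f = refl
sum-concatMap (x ∷ L) g f = trans (sum-++ (g x) (concatMap g L) f) (cong (sumOver (g x) f +_) (sum-concatMap L g f))

sum-comm : (L : List A) (K : List B) (f : A → B → ℚ) →
  sumOver L (λ x → sumOver K (f x)) ≡ sumOver K (λ y → sumOver L (λ x → f x y))
sum-comm []      K f = sym (sum-zero K (λ _ _ → refl))
sum-comm (x ∷ L) K f = trans (cong (sumOver K (f x) +_) (sum-comm L K f)) (sym (sum-+ K (f x) (λ y → sumOver L (λ x → f x y))))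

module Supported {A : Set} (_≟_ : DecidableEquality A) where

  open import Data.List.Membership.DecPropositional _≟_ using (_∈?_)

  remove : A → List A → List A
  remove x = filter (λ y → ¬? (y ≟ x))

  remove-∉ : (x : A) (L : List A) → x ∉ L → remove x L ≡ L
  remove-∉ x []      _  = refl
  remove-∉ x (y ∷ L) x∉ with y ≟ x
  ... | yes refl = ⊥-elim (x∉ (here refl))
  ... | no _     = cong (y ∷_) (remove-∉ x L (x∉ ∘ there))

  sum-remove : (f : A → ℚ) (x : A) (L : List A) → Unique L → x ∈ L → sumOver L f ≡ f x + sumOver (remove x L) f
  sum-remove f x (y ∷ L) (y∉ ∷ u) m with y ≟ x
  ... | yes refl = cong (λ l → f y + sumOver l f) (sym (remove-∉ y L (λ m′ → All.lookup y∉ m′ refl)))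
  sum-remove f x (y ∷ L) (y∉ ∷ u) (here refl) | no y≢x = ⊥-elim (y≢x refl)
  sum-remove f x (y ∷ L) (y∉ ∷ u) (there m)   | no _   =
    trans (cong (f y +_) (sum-remove f x L u m))
      (solve 3 (λ a b c → a :+ (b :+ c) := b :+ (a :+ c)) refl (f y) (f x) (sumOver (remove x L) f))

  sum-≡-supported : (f : A → ℚ) (L K : List A) → Unique L → Unique K →
    (∀ x → x ∈ L → x ∉ K → f x ≡ 0ℚ) → (∀ x → x ∈ K → x ∉ L → f x ≡ 0ℚ) →
    sumOver L f ≡ sumOver K f
  sum-≡-supported f []      K _ _ _ hK = sym (sum-zero K (λ x m → hK x m (λ ())))
  sum-≡-supported f (x ∷ L) K (x∉L ∷ uL) uK hL hK with x ∈? K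
  ... | yes x∈K = trans (cong (f x +_) ih) (sym (sum-remove f x K uK x∈K))
    where
    ih : sumOver L f ≡ sumOver (remove x K) f
    ih = sum-≡-supported f L (remove x K) uL (UniqueP.filter⁺ (λ z → ¬? (z ≟ x)) uK)
      (λ y y∈L y∉K′ → hL y (there y∈L) (λ y∈K → y∉K′ (∈P.∈-filter⁺ (λ z → ¬? (z ≟ x)) y∈K
                                                      (λ { refl → All.lookup x∉L y∈L refl }))))
      (λ y y∈K′ y∉L → let (y∈K , y≢x) = ∈P.∈-filter⁻ (λ z → ¬? (z ≟ x)) {xs = K} y∈K′ in
        hK y y∈K (λ { (here refl) → y≢x refl ; (there y∈L) → y∉L y∈L }))
  ... | no x∉K = trans (cong₂ _+_ (hL x (here refl) x∉K) ih) (+-identityˡ _)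
    where
    ih : sumOver L f ≡ sumOver K f
    ih = sum-≡-supported f L K uL uK (λ y y∈L → hL y (there y∈L))
      (λ y y∈K y∉L → hK y y∈K (λ { (here refl) → x∉K y∈K ; (there y∈L) → y∉L y∈L }))

concatMapWith : (A → B → C) → List A → (A → List B) → List C
concatMapWith t L g = concatMap (λ x → map (t x) (g x)) L

∈-concatMapWith⁺ : (t : A → B → C) (L : List A) (g : A → List B) {x : A} {y : B} →
  x ∈ L → y ∈ g x → t x y ∈ concatMapWith t L g
∈-concatMapWith⁺ t (x ∷ L) g (here refl) y∈ = ∈P.∈-++⁺ˡ (∈P.∈-map⁺ (t x) y∈)
∈-concatMapWith⁺ t (x ∷ L) g (there x∈) y∈ = ∈P.∈-++⁺ʳ (map (t x) (g x)) (∈-concatMapWith⁺ t L g x∈ y∈)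

∈-concatMapWith⁻ : (t : A → B → C) (L : List A) (g : A → List B) {c : C} → c ∈ concatMapWith t L g →
  Σ A λ x → Σ B λ y → x ∈ L × y ∈ g x × c ≡ t x y
∈-concatMapWith⁻ t (x ∷ L) g c∈ with ∈P.∈-++⁻ (map (t x) (g x)) c∈
... | inj₁ c∈₁ = let (y , y∈ , eq) = ∈P.∈-map⁻ (t x) c∈₁ in x , y , here refl , y∈ , eq
... | inj₂ c∈₂ = let (x′ , y , x∈ , y∈ , eq) = ∈-concatMapWith⁻ t L g c∈₂ in x′ , y , there x∈ , y∈ , eq

concatMapWith-unique : (t : A → B → C) → (∀ {x x′ y y′} → t x y ≡ t x′ y′ → x ≡ x′ × y ≡ y′) →
  (L : List A) (g : A → List B) → Unique L → (∀ x → Unique (g x)) → Unique (concatMapWith t L g)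
concatMapWith-unique t inj []      g _          _  = []
concatMapWith-unique t inj (x ∷ L) g (x∉ ∷ uL) ug =
  UniqueP.++⁺ (UniqueP.map⁺ (λ e → proj₂ (inj e)) (ug x)) (concatMapWith-unique t inj L g uL ug) disjoint
  where
  disjoint : Disjoint (map (t x) (g x)) (concatMapWith t L g)
  disjoint (c∈₁ , c∈₂) =
    let (_ , _ , e₁)      = ∈P.∈-map⁻ (t x) c∈₁
        (_ , _ , x′∈ , _ , e₂) = ∈-concatMapWith⁻ t L g c∈₂
    in All.lookup x∉ x′∈ (proj₁ (inj (trans (sym e₁) e₂)))

pairs : List A → (A → List B) → List (A × B)
pairs = concatMapWith _,_

,-injective : ∀ {x x′ : A} {y y′ : B} → (x , y) ≡ (x′ , y′) → x ≡ x′ × y ≡ y′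
,-injective refl = refl , refl

sum-pairs : (L : List A) (g : A → List B) (f : A × B → ℚ) →
  sumOver (pairs L g) f ≡ sumOver L (λ x → sumOver (g x) (λ y → f (x , y)))
sum-pairs L g f = trans (sum-concatMap L (λ x → map (x ,_) (g x)) f)
  (sum-cong L (λ x _ → sum-map (g x) (x ,_) f))

∈-pairs⁻ : (L : List A) (g : A → List B) {x : A} {y : B} → (x , y) ∈ pairs L g → x ∈ L × y ∈ g x
∈-pairs⁻ L g p∈ with ∈-concatMapWith⁻ _,_ L g p∈
... | (_ , _ , x∈ , y∈ , refl) = x∈ , y∈

∈-pairs⁺ : (L : List A) (g : A → List B) {x : A} {y : B} → x ∈ L → y ∈ g x → (x , y) ∈ pairs L g
∈-pairs⁺ = ∈-concatMapWith⁺ _,_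

pairs-unique : (L : List A) (g : A → List B) → Unique L → (∀ x → Unique (g x)) → Unique (pairs L g)
pairs-unique = concatMapWith-unique _,_ ,-injective

map-unique : (g : A → B) (L : List A) → Unique L → (∀ {x y} → x ∈ L → y ∈ L → g x ≡ g y → x ≡ y) →
  Unique (map g L)
map-unique g []      _          _   = []
map-unique g (x ∷ L) (x∉ ∷ uL) inj =
  AllP.map⁺ (All.tabulate (λ y∈ e → All.lookup x∉ y∈ (inj (here refl) (there y∈) e)))
  ∷ map-unique g L uL (λ x∈ y∈ e → inj (there x∈) (there y∈) e)

sum-reindex : DecidableEquality B → (L : List A) (K : List B) (g : A → B) (h : B → A) (f : B → ℚ) →
  Unique L → Unique K →
  (∀ {x} → x ∈ L → g x ∈ K) → (∀ {y} → y ∈ K → h y ∈ L) →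
  (∀ {x} → x ∈ L → h (g x) ≡ x) → (∀ {y} → y ∈ K → g (h y) ≡ y) →
  sumOver L (f ∘ g) ≡ sumOver K f
sum-reindex _≟_ L K g h f uL uK gK hL hg gh =
  trans (sym (sum-map L g f))
    (Supported.sum-≡-supported _≟_ f (map g L) K
      (map-unique g L uL (λ x∈ y∈ e → trans (sym (hg x∈)) (trans (cong h e) (hg y∈))))
      uK
      (λ y y∈ y∉K → ⊥-elim (y∉K (let (x , x∈ , e) = ∈P.∈-map⁻ g y∈ in subst (_∈ K) (sym e) (gK x∈))))
      (λ y y∈K y∉ → ⊥-elim (y∉ (subst (_∈ map g L) (gh y∈K) (∈P.∈-map⁺ g (hL y∈K))))))

upTo-unique : ∀ n → Unique (upTo n)
upTo-unique = UniqueP.upTo⁺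

∈-upTo⇒≤ : ∀ {n i} → i ∈ upTo (suc n) → i ≤ n
∈-upTo⇒≤ = ℕP.≤-pred ∘ ∈P.∈-upTo⁻

T⇒≡true : ∀ {b} → T b → b ≡ true
T⇒≡true {true} _ = refl

¬T⇒≡false : ∀ {b} → ¬ T b → b ≡ false
¬T⇒≡false {false} _  = refl
¬T⇒≡false {true}  ¬t = ⊥-elim (¬t _)

≡ᵇ-true : ∀ {m n} → m ≡ n → (m ≡ᵇ n) ≡ true
≡ᵇ-true = T⇒≡true ∘ ℕP.≡⇒≡ᵇ _ _

≡ᵇ-false : ∀ {m n} → ¬ m ≡ n → (m ≡ᵇ n) ≡ false
≡ᵇ-false m≢n = ¬T⇒≡false (m≢n ∘ ℕP.≡ᵇ⇒≡ _ _)

<ᵇ-true : ∀ {m n} → m < n → (m <ᵇ n) ≡ true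
<ᵇ-true = T⇒≡true ∘ ℕP.<⇒<ᵇ

<ᵇ-false : ∀ {m n} → ¬ m < n → (m <ᵇ n) ≡ false
<ᵇ-false m≮n = ¬T⇒≡false (m≮n ∘ ℕP.<ᵇ⇒< _ _)

≤ᵇ-true : ∀ {m n} → m ≤ n → (m ≤ᵇ n) ≡ true
≤ᵇ-true = T⇒≡true ∘ ℕP.≤⇒≤ᵇ

≤ᵇ-false : ∀ {m n} → ¬ m ≤ n → (m ≤ᵇ n) ≡ false
≤ᵇ-false m≰n = ¬T⇒≡false (m≰n ∘ ℕP.≤ᵇ⇒≤ _ _)

if-true : ∀ {b} {x y : A} → b ≡ true → (if b then x else y) ≡ x
if-true refl = refl

infix 4 _≤ᵥ_
infixl 6 _+ᵥ_ _∸ᵥ_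

_≤ᵥ_ : ∀ {n} → Vec ℕ n → Vec ℕ n → Set
_≤ᵥ_ = Pointwise _≤_

_+ᵥ_ : ∀ {n} → Vec ℕ n → Vec ℕ n → Vec ℕ n
_+ᵥ_ = zipWith ℕ._+_

_∸ᵥ_ : ∀ {n} → Vec ℕ n → Vec ℕ n → Vec ℕ n
_∸ᵥ_ = zipWith _∸_

a+ᵥ[b∸ᵥa]≡b : ∀ {n} {a b : Vec ℕ n} → a ≤ᵥ b → a +ᵥ (b ∸ᵥ a) ≡ b
a+ᵥ[b∸ᵥa]≡b []         = refl
a+ᵥ[b∸ᵥa]≡b (le ∷ les) = cong₂ _∷_ (ℕP.m+[n∸m]≡n le) (a+ᵥ[b∸ᵥa]≡b les)

a+ᵥc∸ᵥa≡c : ∀ {n} (a c : Vec ℕ n) → a +ᵥ c ∸ᵥ a ≡ c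
a+ᵥc∸ᵥa≡c []       []       = refl
a+ᵥc∸ᵥa≡c (a ∷ as) (c ∷ cs) = cong₂ _∷_ (ℕP.m+n∸m≡n a c) (a+ᵥc∸ᵥa≡c as cs)

∸ᵥ-+ᵥ-assoc : ∀ {n} (b c d : Vec ℕ n) → b ∸ᵥ c ∸ᵥ d ≡ b ∸ᵥ (c +ᵥ d)
∸ᵥ-+ᵥ-assoc []       []       []       = refl
∸ᵥ-+ᵥ-assoc (b ∷ bs) (c ∷ cs) (d ∷ ds) = cong₂ _∷_ (ℕP.∸-+-assoc b c d) (∸ᵥ-+ᵥ-assoc bs cs ds)

b∸ᵥ[b∸ᵥa]≡a : ∀ {n} {a b : Vec ℕ n} → a ≤ᵥ b → b ∸ᵥ (b ∸ᵥ a) ≡ a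
b∸ᵥ[b∸ᵥa]≡a []         = refl
b∸ᵥ[b∸ᵥa]≡a (le ∷ les) = cong₂ _∷_ (ℕP.m∸[m∸n]≡n le) (b∸ᵥ[b∸ᵥa]≡a les)

b∸ᵥ0≡b : ∀ {n} (b : Vec ℕ n) → b ∸ᵥ zeroVec ≡ b
b∸ᵥ0≡b []       = refl
b∸ᵥ0≡b (b ∷ bs) = cong (b ∷_) (b∸ᵥ0≡b bs)

a≤ᵥa+ᵥc : ∀ {n} (a c : Vec ℕ n) → a ≤ᵥ a +ᵥ c
a≤ᵥa+ᵥc []       []       = []
a≤ᵥa+ᵥc (a ∷ as) (c ∷ cs) = ℕP.m≤m+n a c ∷ a≤ᵥa+ᵥc as cs

b∸ᵥa≤ᵥb : ∀ {n} (b a : Vec ℕ n) → b ∸ᵥ a ≤ᵥ b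
b∸ᵥa≤ᵥb []       []       = []
b∸ᵥa≤ᵥb (b ∷ bs) (a ∷ as) = ℕP.m∸n≤m b a ∷ b∸ᵥa≤ᵥb bs as

0≤ᵥa : ∀ {n} (a : Vec ℕ n) → zeroVec ≤ᵥ a
0≤ᵥa []       = []
0≤ᵥa (a ∷ as) = z≤n ∷ 0≤ᵥa as

≤ᵥ-trans : ∀ {n} {a b c : Vec ℕ n} → a ≤ᵥ b → b ≤ᵥ c → a ≤ᵥ c
≤ᵥ-trans []       []       = []
≤ᵥ-trans (p ∷ ps) (q ∷ qs) = ℕP.≤-trans p q ∷ ≤ᵥ-trans ps qs

∸ᵥ-monoˡ-≤ᵥ : ∀ {n} {a b : Vec ℕ n} (c : Vec ℕ n) → a ≤ᵥ b → a ∸ᵥ c ≤ᵥ b ∸ᵥ c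
∸ᵥ-monoˡ-≤ᵥ []       []       = []
∸ᵥ-monoˡ-≤ᵥ (c ∷ cs) (p ∷ ps) = ℕP.∸-monoˡ-≤ c p ∷ ∸ᵥ-monoˡ-≤ᵥ cs ps

+ᵥ-≤ᵥ-∸ᵥ : ∀ {n} {b c d : Vec ℕ n} → c ≤ᵥ b → d ≤ᵥ b ∸ᵥ c → c +ᵥ d ≤ᵥ b
+ᵥ-≤ᵥ-∸ᵥ []       []       = []
+ᵥ-≤ᵥ-∸ᵥ (p ∷ ps) (q ∷ qs) = ℕP.≤-trans (ℕP.+-monoʳ-≤ _ q) (ℕP.≤-reflexive (ℕP.m+[n∸m]≡n p)) ∷ +ᵥ-≤ᵥ-∸ᵥ ps qs

sum-+ᵥ : ∀ {n} (a c : Vec ℕ n) → Vec.sum (a +ᵥ c) ≡ Vec.sum a ℕ.+ Vec.sum c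
sum-+ᵥ []       []       = refl
sum-+ᵥ (a ∷ as) (c ∷ cs) = trans (cong ((a ℕ.+ c) ℕ.+_) (sum-+ᵥ as cs))
  (NS.solve 4 (λ a c x y → (a NS.:+ c) NS.:+ (x NS.:+ y) NS.:= (a NS.:+ x) NS.:+ (c NS.:+ y)) refl a c (Vec.sum as) (Vec.sum cs))
  where module NS = Data.Nat.Solver.+-*-Solver

sum-∸ᵥ : ∀ {n} {a b : Vec ℕ n} → a ≤ᵥ b → Vec.sum a ℕ.+ Vec.sum (b ∸ᵥ a) ≡ Vec.sum b
sum-∸ᵥ {a = a} {b} le = trans (sym (sum-+ᵥ a (b ∸ᵥ a))) (cong Vec.sum (a+ᵥ[b∸ᵥa]≡b le))

sum-zeroVec : ∀ {n} → Vec.sum (zeroVec {n}) ≡ 0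
sum-zeroVec {zero}  = refl
sum-zeroVec {suc n} = sum-zeroVec {n}

sum-unitVec : ∀ {n} (j : Fin n) → Vec.sum (unitVec j) ≡ 1
sum-unitVec {suc n} F.zero    = cong suc (sum-zeroVec {n})
sum-unitVec {suc n} (F.suc j) = sum-unitVec j

eqVec-refl : ∀ {n} (a : Vec ℕ n) → eqVec a a ≡ true
eqVec-refl []       = refl
eqVec-refl (a ∷ as) rewrite ≡ᵇ-true {a} refl = eqVec-refl as

eqVec⇒≡ : ∀ {n} (a b : Vec ℕ n) → eqVec a b ≡ true → a ≡ b
eqVec⇒≡ []       []       _ = refl
eqVec⇒≡ (a ∷ as) (b ∷ bs) e with a ≡ᵇ b in eq
... | true = cong₂ _∷_ (ℕP.≡ᵇ⇒≡ a b (subst T (sym eq) _)) (eqVec⇒≡ as bs e)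

box-unique : ∀ {n} (b : Vec ℕ n) → Unique (box b)
box-unique []       = [] ∷ []
box-unique (b ∷ bs) = concatMapWith-unique _∷_ VecP.∷-injective (upTo (suc b)) (λ _ → box bs) (upTo-unique (suc b)) (λ _ → box-unique bs)

∈-box⁺ : ∀ {n} {a b : Vec ℕ n} → a ≤ᵥ b → a ∈ box b
∈-box⁺ []                     = here refl
∈-box⁺ {b = b ∷ bs} (le ∷ les) = ∈-concatMapWith⁺ _∷_ (upTo (suc b)) (λ _ → box bs) (∈P.∈-upTo⁺ (s≤s le)) (∈-box⁺ les)

∈-box⁻ : ∀ {n} (b : Vec ℕ n) {a : Vec ℕ n} → a ∈ box b → a ≤ᵥ b
∈-box⁻ []       {[]} _ = []
∈-box⁻ (b ∷ bs) a∈ with ∈-concatMapWith⁻ _∷_ (upTo (suc b)) (λ _ → box bs) a∈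
... | (_ , _ , x∈ , y∈ , refl) = ∈-upTo⇒≤ x∈ ∷ ∈-box⁻ bs y∈

comps-unique : ∀ m d → Unique (comps m d)
comps-unique zero    zero    = [] ∷ []
comps-unique zero    (suc d) = []
comps-unique (suc m) d       = concatMapWith-unique _∷_ VecP.∷-injective (upTo (suc d)) (λ a → comps m (d ∸ a))
  (upTo-unique (suc d)) (λ a → comps-unique m (d ∸ a))

∈-comps⁺ : ∀ m {d} (a : Vec ℕ m) → Vec.sum a ≡ d → a ∈ comps m d
∈-comps⁺ zero    []       refl = here refl
∈-comps⁺ (suc m) (a ∷ as) refl = ∈-concatMapWith⁺ _∷_ (upTo (suc (a ℕ.+ Vec.sum as))) (λ x → comps m ((a ℕ.+ Vec.sum as) ∸ x))
  (∈P.∈-upTo⁺ (s≤s (ℕP.m≤m+n a _))) (∈-comps⁺ m as (sym (ℕP.m+n∸m≡n a _)))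

∈-comps⁻ : ∀ m d {a : Vec ℕ m} → a ∈ comps m d → Vec.sum a ≡ d
∈-comps⁻ zero    zero    {[]} _ = refl
∈-comps⁻ zero    (suc d) {[]} ()
∈-comps⁻ (suc m) d       a∈ with ∈-concatMapWith⁻ _∷_ (upTo (suc d)) (λ x → comps m (d ∸ x)) a∈
... | (a , _ , x∈ , y∈ , refl) = trans (cong (a ℕ.+_) (∈-comps⁻ m (d ∸ a) y∈)) (ℕP.m+[n∸m]≡n (∈-upTo⇒≤ x∈))

-- Power series

infix 4 _≐_

_≐_ : ∀ {n} → Series n → Series n → Set
P ≐ Q = ∀ b → P b ≡ Q b

≐-setoid : ℕ → Setoid _ _
≐-setoid n = record
  { Carrier       = Series n
  ; _≈_           = _≐_
  ; isEquivalence = record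
    { refl  = λ _ → refl
    ; sym   = λ p b → sym (p b)
    ; trans = λ p q b → trans (p b) (q b)
    }
  }

module ≐-Reasoning {n : ℕ} = SetoidReasoning (≐-setoid n)

≐-refl : ∀ {n} {P : Series n} → P ≐ P
≐-refl _ = refl

≐-sym : ∀ {n} {P Q : Series n} → P ≐ Q → Q ≐ P
≐-sym p b = sym (p b)

≐-trans : ∀ {n} {P Q R : Series n} → P ≐ Q → Q ≐ R → P ≐ R
≐-trans p q b = trans (p b) (q b)

Vec-≟ : ∀ {n} → DecidableEquality (Vec ℕ n)
Vec-≟ = VecP.≡-dec ℕP._≟_

sum-box-box : ∀ {n} (b : Vec ℕ n) (F : Vec ℕ n → Vec ℕ n → ℚ) →
  sumOver (box b) (λ c → sumOver (box (b ∸ᵥ c)) (F c)) ≡ sumOver (box b) (λ a → sumOver (box a) (λ c → F c (a ∸ᵥ c)))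
sum-box-box b F = begin
    sumOver (box b) (λ c → sumOver (box (b ∸ᵥ c)) (F c))
  ≡⟨ sum-pairs (box b) (λ c → box (b ∸ᵥ c)) (λ (c , d) → F c d) ⟨
    sumOver K (λ (c , d) → F c d)
  ≡⟨ sum-reindex (ProdP.≡-dec Vec-≟ Vec-≟) L K g h (λ (c , d) → F c d)
       (pairs-unique (box b) box (box-unique b) box-unique)
       (pairs-unique (box b) (λ c → box (b ∸ᵥ c)) (box-unique b) (λ c → box-unique (b ∸ᵥ c)))
       gK hL hg gh ⟨
    sumOver L (λ (a , c) → F c (a ∸ᵥ c))
  ≡⟨ sum-pairs (box b) box (λ (a , c) → F c (a ∸ᵥ c)) ⟩
    sumOver (box b) (λ a → sumOver (box a) (λ c → F c (a ∸ᵥ c))) ∎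
  where
  open ≡-Reasoning
  L = pairs (box b) box
  K = pairs (box b) (λ c → box (b ∸ᵥ c))
  g : Vec ℕ _ × Vec ℕ _ → Vec ℕ _ × Vec ℕ _
  g (a , c) = c , a ∸ᵥ c
  h : Vec ℕ _ × Vec ℕ _ → Vec ℕ _ × Vec ℕ _
  h (c , d) = c +ᵥ d , c
  gK : ∀ {p} → p ∈ L → g p ∈ K
  gK {a , c} p∈ = let (a∈ , c∈) = ∈-pairs⁻ (box b) box p∈; a≤b = ∈-box⁻ b a∈ in
    ∈-pairs⁺ (box b) (λ c → box (b ∸ᵥ c)) (∈-box⁺ (≤ᵥ-trans (∈-box⁻ a c∈) a≤b)) (∈-box⁺ (∸ᵥ-monoˡ-≤ᵥ c a≤b))
  hL : ∀ {p} → p ∈ K → h p ∈ L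
  hL {c , d} p∈ = let (c∈ , d∈) = ∈-pairs⁻ (box b) (λ c → box (b ∸ᵥ c)) p∈ in
    ∈-pairs⁺ (box b) box (∈-box⁺ (+ᵥ-≤ᵥ-∸ᵥ (∈-box⁻ b c∈) (∈-box⁻ (b ∸ᵥ c) d∈))) (∈-box⁺ (a≤ᵥa+ᵥc c d))
  hg : ∀ {p} → p ∈ L → h (g p) ≡ p
  hg {a , c} p∈ = cong (_, c) (a+ᵥ[b∸ᵥa]≡b (∈-box⁻ a (proj₂ (∈-pairs⁻ (box b) box p∈))))
  gh : ∀ {p} → p ∈ K → g (h p) ≡ p
  gh {c , d} _ = cong (c ,_) (a+ᵥc∸ᵥa≡c c d)

⊗-cong : ∀ {n} {P P′ Q Q′ : Series n} → P ≐ P′ → Q ≐ Q′ → P ⊗ Q ≐ P′ ⊗ Q′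
⊗-cong p q b = sum-cong (box b) (λ a _ → cong₂ _*_ (p a) (q _))

⊗-congˡ : ∀ {n} {P P′ : Series n} (Q : Series n) → P ≐ P′ → P ⊗ Q ≐ P′ ⊗ Q
⊗-congˡ Q p = ⊗-cong p (≐-refl {P = Q})

⊗-congʳ : ∀ {n} (P : Series n) {Q Q′ : Series n} → Q ≐ Q′ → P ⊗ Q ≐ P ⊗ Q′
⊗-congʳ P q = ⊗-cong (≐-refl {P = P}) q

⊗-comm : ∀ {n} (P Q : Series n) → P ⊗ Q ≐ Q ⊗ P
⊗-comm P Q b =
  trans (sum-cong (box b) (λ a a∈ → trans (*-comm (P a) _) (cong (λ x → Q (b ∸ᵥ a) * P x) (sym (b∸ᵥ[b∸ᵥa]≡a (∈-box⁻ b a∈))))))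
    (sum-reindex Vec-≟ (box b) (box b) (b ∸ᵥ_) (b ∸ᵥ_) (λ a → Q a * P (b ∸ᵥ a)) (box-unique b) (box-unique b)
      (λ {a} _ → ∈-box⁺ (b∸ᵥa≤ᵥb b a)) (λ {a} _ → ∈-box⁺ (b∸ᵥa≤ᵥb b a))
      (λ a∈ → b∸ᵥ[b∸ᵥa]≡a (∈-box⁻ b a∈)) (λ a∈ → b∸ᵥ[b∸ᵥa]≡a (∈-box⁻ b a∈)))

⊗-assoc : ∀ {n} (P Q R : Series n) → (P ⊗ Q) ⊗ R ≐ P ⊗ (Q ⊗ R)
⊗-assoc P Q R b = begin
    ((P ⊗ Q) ⊗ R) b
  ≡⟨ sum-cong (box b) (λ a _ → *-distribʳ-sum (box a) (R (b ∸ᵥ a)) (λ c → P c * Q (a ∸ᵥ c))) ⟩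
    sumOver (box b) (λ a → sumOver (box a) (λ c → (P c * Q (a ∸ᵥ c)) * R (b ∸ᵥ a)))
  ≡⟨ sum-cong (box b) (λ a _ → sum-cong (box a) (λ c c∈ → cong (λ x → (P c * Q (a ∸ᵥ c)) * R x) (b∸ᵥa≡ a c c∈))) ⟩
    sumOver (box b) (λ a → sumOver (box a) (λ c → (P c * Q (a ∸ᵥ c)) * R (b ∸ᵥ c ∸ᵥ (a ∸ᵥ c))))
  ≡⟨ sum-box-box b (λ c d → (P c * Q d) * R (b ∸ᵥ c ∸ᵥ d)) ⟨
    sumOver (box b) (λ c → sumOver (box (b ∸ᵥ c)) (λ d → (P c * Q d) * R (b ∸ᵥ c ∸ᵥ d)))
  ≡⟨ sum-cong (box b) (λ c _ → trans (sum-cong (box (b ∸ᵥ c)) (λ d _ → *-assoc (P c) (Q d) _))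
                                     (sym (*-distribˡ-sum (box (b ∸ᵥ c)) (P c) _))) ⟩
    (P ⊗ (Q ⊗ R)) b ∎
  where
  open ≡-Reasoning
  b∸ᵥa≡ : ∀ a c → c ∈ box a → b ∸ᵥ a ≡ b ∸ᵥ c ∸ᵥ (a ∸ᵥ c)
  b∸ᵥa≡ a c c∈ = trans (cong (b ∸ᵥ_) (sym (a+ᵥ[b∸ᵥa]≡b (∈-box⁻ a c∈)))) (sym (∸ᵥ-+ᵥ-assoc b c (a ∸ᵥ c)))

oneS-zeroVec : ∀ {n} → oneS {n} zeroVec ≡ 1ℚ
oneS-zeroVec {n} rewrite eqVec-refl (zeroVec {n}) = refl

oneS-≢zeroVec : ∀ {n} (a : Vec ℕ n) → ¬ a ≡ zeroVec → oneS a ≡ 0ℚ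
oneS-≢zeroVec a a≢0 with eqVec a zeroVec in eq
... | true  = ⊥-elim (a≢0 (eqVec⇒≡ a zeroVec eq))
... | false = refl

⊗-identityˡ : ∀ {n} (Q : Series n) → oneS ⊗ Q ≐ Q
⊗-identityˡ {n} Q b = begin
    sumOver (box b) (λ a → oneS a * Q (b ∸ᵥ a))
  ≡⟨ Supported.sum-≡-supported Vec-≟ _ (box b) (zeroVec {n} ∷ []) (box-unique b) ([] ∷ [])
       (λ a _ a∉ → trans (cong (_* Q (b ∸ᵥ a)) (oneS-≢zeroVec a (a∉ ∘ here))) (*-zeroˡ (Q (b ∸ᵥ a))))
       (λ { _ (here refl) 0∉ → ⊥-elim (0∉ (∈-box⁺ (0≤ᵥa b))) }) ⟩
    oneS (zeroVec {n}) * Q (b ∸ᵥ zeroVec) + 0ℚ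
  ≡⟨ trans (+-identityʳ _) (cong₂ _*_ (oneS-zeroVec {n}) (cong Q (b∸ᵥ0≡b b))) ⟩
    1ℚ * Q b
  ≡⟨ *-identityˡ _ ⟩
    Q b ∎
  where open ≡-Reasoning

⊗-identityʳ : ∀ {n} (Q : Series n) → Q ⊗ oneS ≐ Q
⊗-identityʳ Q = ≐-trans (⊗-comm Q oneS) (⊗-identityˡ Q)

⊗-interchange : ∀ {n} (A B C D : Series n) → (A ⊗ B) ⊗ (C ⊗ D) ≐ (A ⊗ C) ⊗ (B ⊗ D)
⊗-interchange A B C D = begin
  (A ⊗ B) ⊗ (C ⊗ D)  ≈⟨ ⊗-assoc A B (C ⊗ D) ⟩
  A ⊗ (B ⊗ (C ⊗ D))  ≈⟨ ⊗-congʳ A (⊗-assoc B C D) ⟨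
  A ⊗ ((B ⊗ C) ⊗ D)  ≈⟨ ⊗-congʳ A (⊗-congˡ D (⊗-comm B C)) ⟩
  A ⊗ ((C ⊗ B) ⊗ D)  ≈⟨ ⊗-congʳ A (⊗-assoc C B D) ⟩
  A ⊗ (C ⊗ (B ⊗ D))  ≈⟨ ⊗-assoc A C (B ⊗ D) ⟨
  (A ⊗ C) ⊗ (B ⊗ D)  ∎
  where open ≐-Reasoning

powS-cong : ∀ {n} {P P′ : Series n} → P ≐ P′ → ∀ k → powS P k ≐ powS P′ k
powS-cong p zero    = ≐-refl
powS-cong p (suc k) = ⊗-cong p (powS-cong p k)

powS-+ : ∀ {n} (P : Series n) (k l : ℕ) → powS P (k ℕ.+ l) ≐ powS P k ⊗ powS P l
powS-+ P zero    l = ≐-sym (⊗-identityˡ (powS P l))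
powS-+ P (suc k) l = ≐-trans (⊗-congʳ P (powS-+ P k l)) (≐-sym (⊗-assoc P (powS P k) (powS P l)))

Homogeneous : ∀ {n} → ℕ → Series n → Set
Homogeneous d P = ∀ b → ¬ Vec.sum b ≡ d → P b ≡ 0ℚ

Homogeneous-resp-≐ : ∀ {n d} {P P′ : Series n} → P ≐ P′ → Homogeneous d P′ → Homogeneous d P
Homogeneous-resp-≐ p h b b≢ = trans (p b) (h b b≢)

oneS-homogeneous : ∀ {n} → Homogeneous 0 (oneS {n})
oneS-homogeneous {n} b b≢ = oneS-≢zeroVec b (λ e → b≢ (trans (cong Vec.sum e) (sum-zeroVec {n})))

linForm-homogeneous : ∀ {n} (c : Fin n → ℚ) → Homogeneous 1 (linForm c)
linForm-homogeneous {n} c b b≢ = sum-zero (allFin n) term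
  where
  term : ∀ j → j ∈ allFin n → (if eqVec b (unitVec j) then c j else 0ℚ) ≡ 0ℚ
  term j _ with eqVec b (unitVec j) in eq
  ... | true  = ⊥-elim (b≢ (trans (cong Vec.sum (eqVec⇒≡ b (unitVec j) eq)) (sum-unitVec j)))
  ... | false = refl

⊗-homogeneous : ∀ {n d e} {P Q : Series n} → Homogeneous d P → Homogeneous e Q → Homogeneous (d ℕ.+ e) (P ⊗ Q)
⊗-homogeneous {d = d} {P = P} {Q} hP hQ b b≢ = sum-zero (box b) term
  where
  term : ∀ a → a ∈ box b → P a * Q (b ∸ᵥ a) ≡ 0ℚ
  term a a∈ with Vec.sum a ℕP.≟ d
  ... | yes a≡ = trans (cong (P a *_) (hQ (b ∸ᵥ a) (λ b∸a≡ → b≢ (trans (sym (sum-∸ᵥ (∈-box⁻ b a∈))) (cong₂ ℕ._+_ a≡ b∸a≡)))))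
                       (*-zeroʳ (P a))
  ... | no a≢  = trans (cong (_* Q (b ∸ᵥ a)) (hP a a≢)) (*-zeroˡ (Q (b ∸ᵥ a)))

powS-homogeneous : ∀ {n d} {P : Series n} → Homogeneous d P → ∀ k → Homogeneous (k ℕ.* d) (powS P k)
powS-homogeneous h zero    = oneS-homogeneous
powS-homogeneous h (suc k) = ⊗-homogeneous h (powS-homogeneous h k)

monoSub-∷ : ∀ {m n} (M : Fin (suc m) → Fin n → ℚ) (x : ℕ) (xs : Vec ℕ m) →
  monoSub M (x ∷ xs) ≐ powS (linForm (M F.zero)) x ⊗ monoSub (M ∘ F.suc) xs
monoSub-∷ {m} M x xs b = cong (λ S → (powS (linForm (M F.zero)) x ⊗ S) b)
  (trans (cong (foldr f oneS) (sym (ListP.map-tabulate (λ i → i) F.suc)))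
         (ListP.foldr-map f F.suc oneS (allFin m)))
  where
  f : Fin (suc m) → Series _ → Series _
  f i acc = powS (linForm (M i)) (lookup (x ∷ xs) i) ⊗ acc

monoSub-homogeneous : ∀ {m n} (M : Fin m → Fin n → ℚ) (a : Vec ℕ m) → Homogeneous (Vec.sum a) (monoSub M a)
monoSub-homogeneous M []       = oneS-homogeneous
monoSub-homogeneous M (x ∷ xs) = Homogeneous-resp-≐ (monoSub-∷ M x xs)
  (⊗-homogeneous (subst (λ d → Homogeneous d (powS (linForm (M F.zero)) x)) (ℕP.*-identityʳ x) (powS-homogeneous (linForm-homogeneous (M F.zero)) x))
                 (monoSub-homogeneous (M ∘ F.suc) xs))

monoSub-zeroVec : ∀ {m n} (M : Fin m → Fin n → ℚ) → monoSub M zeroVec ≐ oneS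
monoSub-zeroVec {zero}  M = ≐-refl
monoSub-zeroVec {suc m} M = ≐-trans (monoSub-∷ M 0 zeroVec) (≐-trans (⊗-identityˡ _) (monoSub-zeroVec (M ∘ F.suc)))

monoSub-unitVec : ∀ {m n} (M : Fin m → Fin n → ℚ) (j : Fin m) → monoSub M (unitVec j) ≐ linForm (M j)
monoSub-unitVec {suc m} M F.zero = begin
  monoSub M (unitVec F.zero)                          ≈⟨ monoSub-∷ M 1 zeroVec ⟩
  powS ℓ 1 ⊗ monoSub (M ∘ F.suc) zeroVec             ≈⟨ ⊗-congʳ (powS ℓ 1) (monoSub-zeroVec (M ∘ F.suc)) ⟩
  powS ℓ 1 ⊗ oneS                                     ≈⟨ ⊗-identityʳ (powS ℓ 1) ⟩
  ℓ ⊗ oneS                                            ≈⟨ ⊗-identityʳ ℓ ⟩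
  ℓ                                                   ∎
  where
  open ≐-Reasoning
  ℓ = linForm (M F.zero)
monoSub-unitVec {suc m} M (F.suc j) =
  ≐-trans (monoSub-∷ M 0 (unitVec j)) (≐-trans (⊗-identityˡ _) (monoSub-unitVec (M ∘ F.suc) j))

monoSub-+ᵥ : ∀ {m n} (M : Fin m → Fin n → ℚ) (a a′ : Vec ℕ m) → monoSub M (a +ᵥ a′) ≐ monoSub M a ⊗ monoSub M a′
monoSub-+ᵥ M []       []       = ≐-sym (⊗-identityˡ oneS)
monoSub-+ᵥ M (x ∷ xs) (y ∷ ys) = begin
  monoSub M (x ℕ.+ y ∷ xs +ᵥ ys)                             ≈⟨ monoSub-∷ M (x ℕ.+ y) (xs +ᵥ ys) ⟩
  powS ℓ (x ℕ.+ y) ⊗ monoSub (M ∘ F.suc) (xs +ᵥ ys)           ≈⟨ ⊗-cong (powS-+ ℓ x y) (monoSub-+ᵥ (M ∘ F.suc) xs ys) ⟩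
  (powS ℓ x ⊗ powS ℓ y) ⊗ (monoSub (M ∘ F.suc) xs ⊗ monoSub (M ∘ F.suc) ys)
    ≈⟨ ⊗-interchange (powS ℓ x) (powS ℓ y) (monoSub (M ∘ F.suc) xs) (monoSub (M ∘ F.suc) ys) ⟩
  (powS ℓ x ⊗ monoSub (M ∘ F.suc) xs) ⊗ (powS ℓ y ⊗ monoSub (M ∘ F.suc) ys)
    ≈⟨ ⊗-cong (monoSub-∷ M x xs) (monoSub-∷ M y ys) ⟨
  monoSub M (x ∷ xs) ⊗ monoSub M (y ∷ ys)                     ∎
  where
  open ≐-Reasoning
  ℓ = linForm (M F.zero)

linForm-cong : ∀ {n} {c c′ : Fin n → ℚ} → (∀ j → c j ≡ c′ j) → linForm c ≐ linForm c′
linForm-cong {n} c≡c′ b = sum-cong (allFin n) (λ j _ → cong (if eqVec b (unitVec j) then_else 0ℚ) (c≡c′ j))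

monoSub-cong : ∀ {m n} {M M′ : Fin m → Fin n → ℚ} → (∀ i j → M i j ≡ M′ i j) → ∀ a → monoSub M a ≐ monoSub M′ a
monoSub-cong M≡M′ []                     = ≐-refl
monoSub-cong {M = M} {M′} M≡M′ (x ∷ xs) = begin
  monoSub M (x ∷ xs)                                          ≈⟨ monoSub-∷ M x xs ⟩
  powS (linForm (M F.zero)) x ⊗ monoSub (M ∘ F.suc) xs
    ≈⟨ ⊗-cong (powS-cong (linForm-cong (M≡M′ F.zero)) x) (monoSub-cong (M≡M′ ∘ F.suc) xs) ⟩
  powS (linForm (M′ F.zero)) x ⊗ monoSub (M′ ∘ F.suc) xs      ≈⟨ monoSub-∷ M′ x xs ⟨
  monoSub M′ (x ∷ xs)                                         ∎
  where open ≐-Reasoning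

-- Linear substitution

infixl 7 _·_

_·_ : ∀ {m k n} → (Fin m → Fin k → ℚ) → (Fin k → Fin n → ℚ) → Fin m → Fin n → ℚ
_·_ {k = k} M N i l = sumOver (allFin k) (λ j → M i j * N j l)

*-if : (t : Bool) (c x : ℚ) → c * (if t then x else 0ℚ) ≡ (if t then c * x else 0ℚ)
*-if true  c x = refl
*-if false c x = *-zeroʳ c

sum-if : (t : Bool) (L : List A) (f : A → ℚ) →
  sumOver L (λ x → if t then f x else 0ℚ) ≡ (if t then sumOver L f else 0ℚ)
sum-if true  L f = refl
sum-if false L f = sum-zero L (λ _ _ → refl)

linSubst-congˡ : ∀ {m n} {P P′ : Series m} (M : Fin m → Fin n → ℚ) → P ≐ P′ → linSubst P M ≐ linSubst P′ M
linSubst-congˡ {m} M P≐P′ b = sum-cong (comps m (Vec.sum b)) (λ a _ → cong (_* monoSub M a b) (P≐P′ a))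

linSubst-congʳ : ∀ {m n} (P : Series m) {M M′ : Fin m → Fin n → ℚ} → (∀ i j → M i j ≡ M′ i j) → linSubst P M ≐ linSubst P M′
linSubst-congʳ {m} P M≡M′ b = sum-cong (comps m (Vec.sum b)) (λ a _ → cong (P a *_) (monoSub-cong M≡M′ a b))

linSubst-sum : ∀ {m n} (L : List A) (F : A → Series m) (M : Fin m → Fin n → ℚ) →
  linSubst (λ e → sumOver L (λ x → F x e)) M ≐ (λ b → sumOver L (λ x → linSubst (F x) M b))
linSubst-sum {m = m} L F M b =
  trans (sum-cong (comps m (Vec.sum b)) (λ a _ → *-distribʳ-sum L (monoSub M a b) (λ x → F x a)))
        (sum-comm (comps m (Vec.sum b)) L (λ a x → F x a * monoSub M a b))

linSubst-scale : ∀ {m n} (c : ℚ) (P : Series m) (M : Fin m → Fin n → ℚ) →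
  linSubst (λ e → c * P e) M ≐ (λ b → c * linSubst P M b)
linSubst-scale {m} c P M b =
  trans (sum-cong (comps m (Vec.sum b)) (λ a _ → *-assoc c (P a) _))
        (sym (*-distribˡ-sum (comps m (Vec.sum b)) c (λ a → P a * monoSub M a b)))

linSubst-single : ∀ {m n} (P : Series m) (a : Vec ℕ m) (M : Fin m → Fin n → ℚ) →
  (∀ x → ¬ x ≡ a → P x ≡ 0ℚ) → linSubst P M ≐ (λ b → P a * monoSub M a b)
linSubst-single {m} P a M P-single b =
  trans (Supported.sum-≡-supported Vec-≟ _ (comps m (Vec.sum b)) (a ∷ []) (comps-unique m _) ([] ∷ [])
          (λ x _ x∉ → trans (cong (_* monoSub M x b) (P-single x (x∉ ∘ here))) (*-zeroˡ (monoSub M x b)))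
          (λ { _ (here refl) a∉ → trans (cong (P a *_) (monoSub-homogeneous M a b (λ e → a∉ (∈-comps⁺ m a (sym e)))))
                                        (*-zeroʳ (P a)) }))
        (+-identityʳ _)

linSubst-oneS : ∀ {m n} (M : Fin m → Fin n → ℚ) → linSubst (oneS {m}) M ≐ oneS
linSubst-oneS {m} M b =
  trans (linSubst-single oneS zeroVec M oneS-≢zeroVec b)
        (trans (cong (_* monoSub M zeroVec b) (oneS-zeroVec {m})) (trans (*-identityˡ _) (monoSub-zeroVec M b)))

linSubst-linForm : ∀ {m n} (c : Fin m → ℚ) (N : Fin m → Fin n → ℚ) →
  linSubst (linForm c) N ≐ linForm (λ l → sumOver (allFin m) (λ j → c j * N j l))
linSubst-linForm {m} {n} c N b = begin
    linSubst (linForm c) N b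
  ≡⟨ linSubst-sum (allFin m) δ N b ⟩
    sumOver (allFin m) (λ j → linSubst (δ j) N b)
  ≡⟨ sum-cong (allFin m) (λ j _ → linSubst-single (δ j) (unitVec j) N (δ-single j) b) ⟩
    sumOver (allFin m) (λ j → δ j (unitVec j) * monoSub N (unitVec j) b)
  ≡⟨ sum-cong (allFin m) (λ j _ → cong₂ _*_ (cong (if_then c j else 0ℚ) (eqVec-refl (unitVec j))) (monoSub-unitVec N j b)) ⟩
    sumOver (allFin m) (λ j → c j * linForm (N j) b)
  ≡⟨ sum-cong (allFin m) (λ j _ → trans (*-distribˡ-sum (allFin n) (c j) _) (sum-cong (allFin n) (λ l _ → *-if (t l) (c j) (N j l)))) ⟩
    sumOver (allFin m) (λ j → sumOver (allFin n) (λ l → if t l then c j * N j l else 0ℚ))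
  ≡⟨ sum-comm (allFin m) (allFin n) (λ j l → if t l then c j * N j l else 0ℚ) ⟩
    sumOver (allFin n) (λ l → sumOver (allFin m) (λ j → if t l then c j * N j l else 0ℚ))
  ≡⟨ sum-cong (allFin n) (λ l _ → sum-if (t l) (allFin m) (λ j → c j * N j l)) ⟩
    linForm (λ l → sumOver (allFin m) (λ j → c j * N j l)) b ∎
  where
  open ≡-Reasoning
  δ : Fin m → Series m
  δ j e = if eqVec e (unitVec j) then c j else 0ℚ
  δ-single : ∀ j x → ¬ x ≡ unitVec j → δ j x ≡ 0ℚ
  δ-single j x x≢ with eqVec x (unitVec j) in eq
  ... | true  = ⊥-elim (x≢ (eqVec⇒≡ x (unitVec j) eq))
  ... | false = refl
  t : Fin n → Bool
  t l = eqVec b (unitVec l)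

-- Reindex by (a , x) ↦ (x , a ∸ x); the vanishing of G makes the two supports agree.
sum-comps-box : ∀ m d₁ d₂ (G : Vec ℕ m → Vec ℕ m → ℚ) → (∀ x y → ¬ Vec.sum x ≡ d₁ → G x y ≡ 0ℚ) →
  sumOver (comps m (d₁ ℕ.+ d₂)) (λ a → sumOver (box a) (λ x → G x (a ∸ᵥ x)))
    ≡ sumOver (comps m d₁) (λ x → sumOver (comps m d₂) (G x))
sum-comps-box m d₁ d₂ G G-vanishes = begin
    sumOver (comps m (d₁ ℕ.+ d₂)) (λ a → sumOver (box a) (λ x → G x (a ∸ᵥ x)))
  ≡⟨ sum-pairs (comps m (d₁ ℕ.+ d₂)) box (G′ ∘ φ) ⟨
    sumOver L (G′ ∘ φ)
  ≡⟨ sum-map L φ G′ ⟨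
    sumOver (map φ L) G′
  ≡⟨ Supported.sum-≡-supported (ProdP.≡-dec Vec-≟ Vec-≟) G′ (map φ L) K φL-unique K-unique outsideK outsideφL ⟩
    sumOver K G′
  ≡⟨ sum-pairs (comps m d₁) (λ _ → comps m d₂) G′ ⟩
    sumOver (comps m d₁) (λ x → sumOver (comps m d₂) (G x)) ∎
  where
  open ≡-Reasoning
  L = pairs (comps m (d₁ ℕ.+ d₂)) box
  K = pairs (comps m d₁) (λ _ → comps m d₂)
  φ : Vec ℕ m × Vec ℕ m → Vec ℕ m × Vec ℕ m
  φ (a , x) = x , a ∸ᵥ x
  G′ : Vec ℕ m × Vec ℕ m → ℚ
  G′ (x , y) = G x y
  K-unique : Unique K
  K-unique = pairs-unique (comps m d₁) (λ _ → comps m d₂) (comps-unique m d₁) (λ _ → comps-unique m d₂)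
  x≤ᵥa : ∀ {a x} → (a , x) ∈ L → x ≤ᵥ a
  x≤ᵥa {a} p∈ = ∈-box⁻ a (proj₂ (∈-pairs⁻ (comps m (d₁ ℕ.+ d₂)) box p∈))
  φL-unique : Unique (map φ L)
  φL-unique = map-unique φ L (pairs-unique (comps m (d₁ ℕ.+ d₂)) box (comps-unique m _) box-unique) φ-injective
    where
    φ-injective : ∀ {p q} → p ∈ L → q ∈ L → φ p ≡ φ q → p ≡ q
    φ-injective {a , x} {a′ , x′} p∈ q∈ e with ,-injective e
    ... | refl , a∸x≡ = cong (_, x) (begin
      a              ≡⟨ a+ᵥ[b∸ᵥa]≡b (x≤ᵥa p∈) ⟨
      x +ᵥ (a ∸ᵥ x)  ≡⟨ cong (x +ᵥ_) a∸x≡ ⟩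
      x +ᵥ (a′ ∸ᵥ x) ≡⟨ a+ᵥ[b∸ᵥa]≡b (x≤ᵥa q∈) ⟩
      a′             ∎)
  outsideK : ∀ p → p ∈ map φ L → p ∉ K → G′ p ≡ 0ℚ
  outsideK _ p∈ p∉ with ∈P.∈-map⁻ φ p∈
  ... | (a , x) , q∈ , refl with Vec.sum x ℕP.≟ d₁
  ...   | no  x≢ = G-vanishes x (a ∸ᵥ x) x≢
  ...   | yes x≡ = ⊥-elim (p∉ (∈-pairs⁺ (comps m d₁) (λ _ → comps m d₂) (∈-comps⁺ m x x≡) (∈-comps⁺ m (a ∸ᵥ x) a∸x≡)))
    where
    a∸x≡ : Vec.sum (a ∸ᵥ x) ≡ d₂
    a∸x≡ = ℕP.+-cancelˡ-≡ d₁ _ _ (begin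
      d₁ ℕ.+ Vec.sum (a ∸ᵥ x)          ≡⟨ cong (ℕ._+ Vec.sum (a ∸ᵥ x)) x≡ ⟨
      Vec.sum x ℕ.+ Vec.sum (a ∸ᵥ x)   ≡⟨ sum-∸ᵥ (x≤ᵥa q∈) ⟩
      Vec.sum a                        ≡⟨ ∈-comps⁻ m _ (proj₁ (∈-pairs⁻ (comps m (d₁ ℕ.+ d₂)) box q∈)) ⟩
      d₁ ℕ.+ d₂                        ∎)
  outsideφL : ∀ p → p ∈ K → p ∉ map φ L → G′ p ≡ 0ℚ
  outsideφL (x , y) p∈ p∉ = ⊥-elim (p∉ (subst (_∈ map φ L) (cong (x ,_) (a+ᵥc∸ᵥa≡c x y)) (∈P.∈-map⁺ φ x+y∈)))
    where
    x+y∈ : (x +ᵥ y , x) ∈ L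
    x+y∈ = let (x∈ , y∈) = ∈-pairs⁻ (comps m d₁) (λ _ → comps m d₂) p∈ in
      ∈-pairs⁺ (comps m (d₁ ℕ.+ d₂)) box
        (∈-comps⁺ m (x +ᵥ y) (trans (sum-+ᵥ x y) (cong₂ ℕ._+_ (∈-comps⁻ m d₁ x∈) (∈-comps⁻ m d₂ y∈))))
        (∈-box⁺ (a≤ᵥa+ᵥc x y))

linSubst-⊗ : ∀ {m n} (P Q : Series m) (M : Fin m → Fin n → ℚ) → linSubst (P ⊗ Q) M ≐ linSubst P M ⊗ linSubst Q M
linSubst-⊗ {m} P Q M b = begin
    sumOver (comps m (Vec.sum b)) (λ a → (P ⊗ Q) a * μ a b)
  ≡⟨ sum-cong (comps m (Vec.sum b)) (λ a _ → expand a) ⟩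
    sumOver (comps m (Vec.sum b)) (λ a → sumOver (box a) (λ x → sumOver (box b) (λ c → F c x (a ∸ᵥ x))))
  ≡⟨ sum-cong (comps m (Vec.sum b)) (λ a _ → sum-comm (box a) (box b) (λ x c → F c x (a ∸ᵥ x))) ⟩
    sumOver (comps m (Vec.sum b)) (λ a → sumOver (box b) (λ c → sumOver (box a) (λ x → F c x (a ∸ᵥ x))))
  ≡⟨ sum-comm (comps m (Vec.sum b)) (box b) (λ a c → sumOver (box a) (λ x → F c x (a ∸ᵥ x))) ⟩
    sumOver (box b) (λ c → sumOver (comps m (Vec.sum b)) (λ a → sumOver (box a) (λ x → F c x (a ∸ᵥ x))))
  ≡⟨ sum-cong (box b) (λ c c∈ → split c (∈-box⁻ b c∈)) ⟩
    sumOver (box b) (λ c → sumOver (comps m (Vec.sum c)) (λ x → sumOver (comps m (Vec.sum (b ∸ᵥ c))) (F c x)))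
  ≡⟨ sum-cong (box b) (λ c _ → factor c) ⟩
    (linSubst P M ⊗ linSubst Q M) b ∎
  where
  open ≡-Reasoning
  μ = monoSub M
  F : Vec ℕ _ → Vec ℕ m → Vec ℕ m → ℚ
  F c x y = (P x * μ x c) * (Q y * μ y (b ∸ᵥ c))
  expand : ∀ a → (P ⊗ Q) a * μ a b ≡ sumOver (box a) (λ x → sumOver (box b) (λ c → F c x (a ∸ᵥ x)))
  expand a = trans (*-distribʳ-sum (box a) (μ a b) (λ x → P x * Q (a ∸ᵥ x)))
    (sum-cong (box a) (λ x x∈ → begin
      (P x * Q (a ∸ᵥ x)) * μ a b
    ≡⟨ cong (λ a′ → (P x * Q (a ∸ᵥ x)) * μ a′ b) (a+ᵥ[b∸ᵥa]≡b (∈-box⁻ a x∈)) ⟨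
      (P x * Q (a ∸ᵥ x)) * μ (x +ᵥ (a ∸ᵥ x)) b
    ≡⟨ cong ((P x * Q (a ∸ᵥ x)) *_) (monoSub-+ᵥ M x (a ∸ᵥ x) b) ⟩
      (P x * Q (a ∸ᵥ x)) * sumOver (box b) (λ c → μ x c * μ (a ∸ᵥ x) (b ∸ᵥ c))
    ≡⟨ *-distribˡ-sum (box b) (P x * Q (a ∸ᵥ x)) (λ c → μ x c * μ (a ∸ᵥ x) (b ∸ᵥ c)) ⟩
      sumOver (box b) (λ c → (P x * Q (a ∸ᵥ x)) * (μ x c * μ (a ∸ᵥ x) (b ∸ᵥ c)))
    ≡⟨ sum-cong (box b) (λ c _ → solve 4 (λ p q s t → (p :* q) :* (s :* t) := (p :* s) :* (q :* t)) refl
                                        (P x) (Q (a ∸ᵥ x)) (μ x c) (μ (a ∸ᵥ x) (b ∸ᵥ c))) ⟩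
      sumOver (box b) (λ c → F c x (a ∸ᵥ x)) ∎))
  split : ∀ c → c ≤ᵥ b → sumOver (comps m (Vec.sum b)) (λ a → sumOver (box a) (λ x → F c x (a ∸ᵥ x)))
                        ≡ sumOver (comps m (Vec.sum c)) (λ x → sumOver (comps m (Vec.sum (b ∸ᵥ c))) (F c x))
  split c c≤b = trans (cong (λ d → sumOver (comps m d) (λ a → sumOver (box a) (λ x → F c x (a ∸ᵥ x)))) (sym (sum-∸ᵥ c≤b)))
    (sum-comps-box m (Vec.sum c) (Vec.sum (b ∸ᵥ c)) (F c)
      (λ x y x≢ → trans (cong (λ z → (P x * z) * (Q y * μ y (b ∸ᵥ c))) (monoSub-homogeneous M x c (x≢ ∘ sym)))
                        (trans (cong (_* (Q y * μ y (b ∸ᵥ c))) (*-zeroʳ (P x))) (*-zeroˡ (Q y * μ y (b ∸ᵥ c))))))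
  factor : ∀ c → sumOver (comps m (Vec.sum c)) (λ x → sumOver (comps m (Vec.sum (b ∸ᵥ c))) (F c x))
                ≡ linSubst P M c * linSubst Q M (b ∸ᵥ c)
  factor c = trans (sum-cong (comps m (Vec.sum c)) (λ x _ → sym (*-distribˡ-sum (comps m (Vec.sum (b ∸ᵥ c))) (P x * μ x c) _)))
                   (sym (*-distribʳ-sum (comps m (Vec.sum c)) (linSubst Q M (b ∸ᵥ c)) (λ x → P x * μ x c)))

linSubst-powS : ∀ {m n} (P : Series m) (N : Fin m → Fin n → ℚ) (k : ℕ) → linSubst (powS P k) N ≐ powS (linSubst P N) k
linSubst-powS P N zero    = linSubst-oneS N
linSubst-powS P N (suc k) = ≐-trans (linSubst-⊗ P (powS P k) N) (⊗-congʳ (linSubst P N) (linSubst-powS P N k))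

linSubst-monoSub : ∀ {m k n} (M : Fin m → Fin k → ℚ) (N : Fin k → Fin n → ℚ) (a : Vec ℕ m) →
  linSubst (monoSub M a) N ≐ monoSub (M · N) a
linSubst-monoSub M N []       = linSubst-oneS N
linSubst-monoSub M N (x ∷ xs) = begin
  linSubst (monoSub M (x ∷ xs)) N                                      ≈⟨ linSubst-congˡ N (monoSub-∷ M x xs) ⟩
  linSubst (powS (linForm (M F.zero)) x ⊗ monoSub (M ∘ F.suc) xs) N   ≈⟨ linSubst-⊗ (powS (linForm (M F.zero)) x) (monoSub (M ∘ F.suc) xs) N ⟩
  linSubst (powS (linForm (M F.zero)) x) N ⊗ linSubst (monoSub (M ∘ F.suc) xs) N
    ≈⟨ ⊗-cong (≐-trans (linSubst-powS (linForm (M F.zero)) N x) (powS-cong (linSubst-linForm (M F.zero) N) x))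
              (linSubst-monoSub (M ∘ F.suc) N xs) ⟩
  powS (linForm ((M · N) F.zero)) x ⊗ monoSub ((M · N) ∘ F.suc) xs    ≈⟨ monoSub-∷ (M · N) x xs ⟨
  monoSub (M · N) (x ∷ xs)                                             ∎
  where open ≐-Reasoning

linSubst-∘ : ∀ {m k n} (P : Series m) (M : Fin m → Fin k → ℚ) (N : Fin k → Fin n → ℚ) →
  linSubst (linSubst P M) N ≐ linSubst P (M · N)
linSubst-∘ {m} {k} P M N b = begin
    sumOver Cₖ (λ c → linSubst P M c * monoSub N c b)
  ≡⟨ sum-cong Cₖ (λ c c∈ → trans (cong (λ d → sumOver (comps m d) (λ a → P a * monoSub M a c) * monoSub N c b) (∈-comps⁻ k _ c∈))
                                 (*-distribʳ-sum Cₘ (monoSub N c b) (λ a → P a * monoSub M a c))) ⟩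
    sumOver Cₖ (λ c → sumOver Cₘ (λ a → (P a * monoSub M a c) * monoSub N c b))
  ≡⟨ sum-comm Cₖ Cₘ (λ c a → (P a * monoSub M a c) * monoSub N c b) ⟩
    sumOver Cₘ (λ a → sumOver Cₖ (λ c → (P a * monoSub M a c) * monoSub N c b))
  ≡⟨ sum-cong Cₘ (λ a _ → trans (sum-cong Cₖ (λ c _ → *-assoc (P a) _ _))
                                (trans (sym (*-distribˡ-sum Cₖ (P a) (λ c → monoSub M a c * monoSub N c b)))
                                       (cong (P a *_) (linSubst-monoSub M N a b)))) ⟩
    linSubst P (M · N) b ∎
  where
  open ≡-Reasoning
  Cₖ = comps k (Vec.sum b)
  Cₘ = comps m (Vec.sum b)

sum-allFin : ∀ N (h : ℕ → ℚ) → sumOver (allFin N) (h ∘ toℕ) ≡ sumOver (upTo N) h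
sum-allFin zero    h = refl
sum-allFin (suc N) h = cong (h 0 +_) (begin
    sumOver (Data.List.tabulate {n = N} F.suc) (h ∘ toℕ)
  ≡⟨ cong (λ l → sumOver l (h ∘ toℕ)) (ListP.map-tabulate {n = N} (λ i → i) F.suc) ⟨
    sumOver (map F.suc (allFin N)) (h ∘ toℕ)
  ≡⟨ sum-map (allFin N) F.suc (h ∘ toℕ) ⟩
    sumOver (allFin N) (h ∘ suc ∘ toℕ)
  ≡⟨ sum-allFin N (h ∘ suc) ⟩
    sumOver (upTo N) (h ∘ suc)
  ≡⟨ sum-map (upTo N) suc h ⟨
    sumOver (map suc (upTo N)) h
  ≡⟨ cong (λ l → sumOver l h) (ListP.map-upTo suc N) ⟩
    sumOver (Data.List.applyUpTo suc N) h ∎)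
  where open ≡-Reasoning

sum-upTo-single : ∀ N t (h : ℕ → ℚ) → t < N → (∀ w → w < N → ¬ w ≡ t → h w ≡ 0ℚ) → sumOver (upTo N) h ≡ h t
sum-upTo-single N t h t<N h-single = trans
  (Supported.sum-≡-supported ℕP._≟_ h (upTo N) (t ∷ []) (upTo-unique N) ([] ∷ [])
     (λ w w∈ w∉ → h-single w (∈P.∈-upTo⁻ w∈) (w∉ ∘ here))
     (λ { _ (here refl) t∉ → ⊥-elim (t∉ (∈P.∈-upTo⁺ t<N)) }))
  (+-identityʳ (h t))

sum-upTo-zero : ∀ N (h : ℕ → ℚ) → (∀ w → w < N → h w ≡ 0ℚ) → sumOver (upTo N) h ≡ 0ℚ
sum-upTo-zero N h h≡0 = sum-zero (upTo N) (λ w w∈ → h≡0 w (∈P.∈-upTo⁻ w∈))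

sum-upTo-window : ∀ N r L (h : ℕ → ℚ) → r ℕ.+ L ≤ N → (∀ w → w < N → w < r ⊎ r ℕ.+ L ≤ w → h w ≡ 0ℚ) →
  sumOver (upTo N) h ≡ sumOver (upTo L) (λ q → h (r ℕ.+ q))
sum-upTo-window N r L h r+L≤N outside = trans
  (Supported.sum-≡-supported ℕP._≟_ h (upTo N) (map (r ℕ.+_) (upTo L)) (upTo-unique N)
     (UniqueP.map⁺ (ℕP.+-cancelˡ-≡ r _ _) (upTo-unique L)) outsideWindow outsideRange)
  (sum-map (upTo L) (r ℕ.+_) h)
  where
  outsideWindow : ∀ w → w ∈ upTo N → w ∉ map (r ℕ.+_) (upTo L) → h w ≡ 0ℚ
  outsideWindow w w∈ w∉ with w ℕP.<? r | r ℕ.+ L ℕP.≤? w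
  ... | yes w<r | _        = outside w (∈P.∈-upTo⁻ w∈) (inj₁ w<r)
  ... | no _    | yes r+L≤w = outside w (∈P.∈-upTo⁻ w∈) (inj₂ r+L≤w)
  ... | no w≮r  | no r+L≰w = ⊥-elim (w∉ (subst (_∈ map (r ℕ.+_) (upTo L)) r+[w∸r]≡w
                               (∈P.∈-map⁺ (r ℕ.+_) (∈P.∈-upTo⁺ w∸r<L))))
    where
    r+[w∸r]≡w = ℕP.m+[n∸m]≡n (ℕP.≮⇒≥ w≮r)
    w∸r<L : w ∸ r < L
    w∸r<L = ℕP.+-cancelˡ-< r _ _ (subst (_< r ℕ.+ L) (sym r+[w∸r]≡w) (ℕP.≰⇒> r+L≰w))
  outsideRange : ∀ w → w ∈ map (r ℕ.+_) (upTo L) → w ∉ upTo N → h w ≡ 0ℚ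
  outsideRange w w∈ w∉ with ∈P.∈-map⁻ (r ℕ.+_) w∈
  ... | q , q∈ , refl = ⊥-elim (w∉ (∈P.∈-upTo⁺ (ℕP.<-≤-trans (ℕP.+-monoʳ-< r (∈P.∈-upTo⁻ q∈)) r+L≤N)))

sum-upTo-≡ᵇ : ∀ r V L (c : ℚ) →
  sumOver (upTo L) (λ q → if V ≡ᵇ (r ℕ.+ q) then c else 0ℚ) ≡ (if (r ≤ᵇ V) ∧ ((V ∸ r) <ᵇ L) then c else 0ℚ)
sum-upTo-≡ᵇ r V L c with r ℕP.≤? V
... | no r≰V = trans (sum-upTo-zero L _ (λ q _ → cong (if_then c else 0ℚ) (≡ᵇ-false (λ e → r≰V (subst (r ≤_) (sym e) (ℕP.m≤m+n r q))))))
                     (cong (λ b → if b ∧ ((V ∸ r) <ᵇ L) then c else 0ℚ) (sym (≤ᵇ-false r≰V)))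
... | yes r≤V with (V ∸ r) ℕP.<? L
...   | yes V∸r<L = trans (sum-upTo-single L (V ∸ r) _ V∸r<L
                            (λ q _ q≢ → cong (if_then c else 0ℚ) (≡ᵇ-false (λ e → q≢ (trans (sym (ℕP.m+n∸m≡n r q)) (cong (_∸ r) (sym e)))))))
                          (trans (cong (if_then c else 0ℚ) (≡ᵇ-true (sym (ℕP.m+[n∸m]≡n r≤V))))
                                 (sym (cong₂ (λ b₁ b₂ → if b₁ ∧ b₂ then c else 0ℚ) (≤ᵇ-true r≤V) (<ᵇ-true V∸r<L))))
...   | no V∸r≮L = trans (sum-upTo-zero L _ (λ q q<L → cong (if_then c else 0ℚ)
                                 (≡ᵇ-false (λ e → V∸r≮L (subst (_< L) (sym (trans (cong (_∸ r) e) (ℕP.m+n∸m≡n r q))) q<L)))))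
                         (sym (cong₂ (λ b₁ b₂ → if b₁ ∧ b₂ then c else 0ℚ) (≤ᵇ-true r≤V) (<ᵇ-false V∸r≮L)))

-- The substitution matrices

-- Row p of negYSums r d is -(Y₁ + … + Y_{d-p}), so linSubst (βser β d) (negYSums r d) is β(-Y₁-…-Y_d, …, -Y₁).
negYSums : (r d : ℕ) → Fin d → Fin (r ℕ.+ r) → ℚ
negYSums r d p v = if (r ≤ᵇ toℕ v) ∧ ((toℕ v ∸ r) <ᵇ (d ∸ toℕ p)) then - 1ℚ else 0ℚ

-- Row p of XBlock r d t is X_{t+p+1}, so linSubst (βser β d) (XBlock r d t) is β(X_{t+1}, …, X_{t+d}).
XBlock : (r d t : ℕ) → Fin d → Fin (r ℕ.+ r) → ℚ
XBlock r d t p v = if toℕ v ≡ᵇ (t ℕ.+ toℕ p) then 1ℚ else 0ℚ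

-- Nt and Sw read at the values of their Fin indices; SwYℕ r V q is the entry of Sw r in row r + q, column V.
Ntℕ : ℕ → ℕ → ℕ → ℕ → ℚ
Ntℕ r i w V = if w <ᵇ (r ∸ i) then (if V ≡ᵇ (i ℕ.+ w) then 1ℚ else 0ℚ)
              else (if V ≡ᵇ (r ℕ.+ (w ∸ (r ∸ i))) then - 1ℚ else 0ℚ)

Swℕ : ℕ → ℕ → ℕ → ℚ
Swℕ r w V = if w <ᵇ r then (if (r ≤ᵇ V) ∧ ((V ∸ r) <ᵇ (r ∸ w)) then - 1ℚ else 0ℚ)
            else ((if V ≡ᵇ (r ∸ 1 ∸ (w ∸ r)) then - 1ℚ else 0ℚ) + (if (1 ≤ᵇ (w ∸ r)) ∧ (V ≡ᵇ (r ∸ (w ∸ r))) then 1ℚ else 0ℚ))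

SwYℕ : ℕ → ℕ → ℕ → ℚ
SwYℕ r V q = (if V ≡ᵇ (r ∸ 1 ∸ q) then - 1ℚ else 0ℚ) + (if (1 ≤ᵇ q) ∧ (V ≡ᵇ (r ∸ q)) then 1ℚ else 0ℚ)

indicator : Bool → ℚ
indicator b = if b then 1ℚ else 0ℚ

-- Y₁ ↦ -X_r and Y_q ↦ X_{r-q+2} - X_{r-q+1} make Y₁ + … + Y_{L+1} telescope to -X_{r-L}.
sum-SwYℕ : ∀ r V L → sumOver (upTo (suc L)) (SwYℕ r V) ≡ - indicator (V ≡ᵇ (r ∸ suc L))
sum-SwYℕ r V zero    = base (V ≡ᵇ (r ∸ 1))
  where
  base : ∀ b → ((if b then - 1ℚ else 0ℚ) + 0ℚ) + 0ℚ ≡ - indicator b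
  base true  = refl
  base false = refl
sum-SwYℕ r V (suc L) = begin
    sumOver (upTo (suc (suc L))) (SwYℕ r V)
  ≡⟨ cong (λ l → sumOver l (SwYℕ r V)) (ListP.upTo-∷ʳ (suc L)) ⟨
    sumOver (upTo (suc L) ++ (suc L ∷ [])) (SwYℕ r V)
  ≡⟨ sum-++ (upTo (suc L)) (suc L ∷ []) (SwYℕ r V) ⟩
    sumOver (upTo (suc L)) (SwYℕ r V) + (SwYℕ r V (suc L) + 0ℚ)
  ≡⟨ cong₂ _+_ (sum-SwYℕ r V L)
       (cong (λ x → ((if V ≡ᵇ x then - 1ℚ else 0ℚ) + (if V ≡ᵇ (r ∸ suc L) then 1ℚ else 0ℚ)) + 0ℚ) (ℕP.∸-+-assoc r 1 (suc L))) ⟩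
    - indicator (V ≡ᵇ (r ∸ suc L)) + (((if V ≡ᵇ (r ∸ suc (suc L)) then - 1ℚ else 0ℚ) + (if V ≡ᵇ (r ∸ suc L) then 1ℚ else 0ℚ)) + 0ℚ)
  ≡⟨ step (V ≡ᵇ (r ∸ suc L)) (V ≡ᵇ (r ∸ suc (suc L))) ⟩
    - indicator (V ≡ᵇ (r ∸ suc (suc L))) ∎
  where
  open ≡-Reasoning
  step : ∀ b₁ b₂ → - indicator b₁ + (((if b₂ then - 1ℚ else 0ℚ) + (if b₁ then 1ℚ else 0ℚ)) + 0ℚ) ≡ - indicator b₂
  step true  true  = refl
  step true  false = refl
  step false true  = refl
  step false false = refl

ifOne-false-* : ∀ (b : Bool) (x : ℚ) → b ≡ false → (if b then 1ℚ else 0ℚ) * x ≡ 0ℚ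
ifOne-false-* false x refl = *-zeroˡ x

ifMinusOne-false-* : ∀ (b : Bool) (x : ℚ) → b ≡ false → (if b then - 1ℚ else 0ℚ) * x ≡ 0ℚ
ifMinusOne-false-* false x refl = *-zeroˡ x

MY·Nt : ∀ r i j k (p : Fin (j ∸ k)) (v : Fin (r ℕ.+ r)) → j ≤ r ∸ i → k ≤ j →
  (MY (r ∸ i) j k · Nt r i) p v ≡ negYSums r (j ∸ k) p v
MY·Nt r i j k p v j≤ k≤j = begin
    sumOver (allFin (r′ ℕ.+ r′)) (h ∘ toℕ)
  ≡⟨ sum-allFin (r′ ℕ.+ r′) h ⟩
    sumOver (upTo (r′ ℕ.+ r′)) h
  ≡⟨ sum-upTo-window (r′ ℕ.+ r′) r′ L h (ℕP.+-monoʳ-≤ r′ L≤r′) outside ⟩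
    sumOver (upTo L) (λ q → h (r′ ℕ.+ q))
  ≡⟨ sum-cong (upTo L) (λ q q∈ → inside q (∈P.∈-upTo⁻ q∈)) ⟩
    sumOver (upTo L) (λ q → if V ≡ᵇ (r ℕ.+ q) then - 1ℚ else 0ℚ)
  ≡⟨ sum-upTo-≡ᵇ r V L (- 1ℚ) ⟩
    negYSums r (j ∸ k) p v ∎
  where
  open ≡-Reasoning
  r′ = r ∸ i
  V = toℕ v
  L = j ∸ k ∸ toℕ p
  h : ℕ → ℚ
  h w = (if (r′ ≤ᵇ w) ∧ ((w ∸ r′) <ᵇ L) then 1ℚ else 0ℚ) * Ntℕ r i w V
  L≤r′ : L ≤ r′
  L≤r′ = ℕP.≤-trans (ℕP.m∸n≤m (j ∸ k) (toℕ p)) (ℕP.≤-trans (ℕP.m∸n≤m j k) j≤)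
  outside : ∀ w → w < r′ ℕ.+ r′ → w < r′ ⊎ r′ ℕ.+ L ≤ w → h w ≡ 0ℚ
  outside w _ (inj₁ w<r′)   = ifOne-false-* _ (Ntℕ r i w V) (cong (_∧ ((w ∸ r′) <ᵇ L)) (≤ᵇ-false (ℕP.<⇒≱ w<r′)))
  outside w _ (inj₂ r′+L≤w) = ifOne-false-* _ (Ntℕ r i w V)
    (trans (cong ((r′ ≤ᵇ w) ∧_) (<ᵇ-false (ℕP.≤⇒≯ (ℕP.≤-trans (ℕP.≤-reflexive (sym (ℕP.m+n∸m≡n r′ L))) (ℕP.∸-monoˡ-≤ r′ r′+L≤w)))))
           (∧-zeroʳ _))
  inside : ∀ q → q < L → h (r′ ℕ.+ q) ≡ (if V ≡ᵇ (r ℕ.+ q) then - 1ℚ else 0ℚ)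
  inside q q<L rewrite ≤ᵇ-true (ℕP.m≤m+n r′ q) | ℕP.m+n∸m≡n r′ q | <ᵇ-true q<L | <ᵇ-false (ℕP.≤⇒≯ (ℕP.m≤m+n r′ q)) =
    *-identityˡ _

MX·Nt : ∀ r i j (p : Fin (r ∸ i ∸ j)) (v : Fin (r ℕ.+ r)) →
  (MX (r ∸ i) j · Nt r i) p v ≡ XBlock r (r ∸ i ∸ j) (i ℕ.+ j) p v
MX·Nt r i j p v = begin
    sumOver (allFin (r′ ℕ.+ r′)) (h ∘ toℕ)
  ≡⟨ sum-allFin (r′ ℕ.+ r′) h ⟩
    sumOver (upTo (r′ ℕ.+ r′)) h
  ≡⟨ sum-upTo-single (r′ ℕ.+ r′) (j ℕ.+ P) h (ℕP.<-≤-trans j+P<r′ (ℕP.m≤m+n r′ r′)) (λ w _ w≢ → ifOne-false-* _ (Ntℕ r i w V) (≡ᵇ-false w≢)) ⟩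
    h (j ℕ.+ P)
  ≡⟨ cong (λ b → (if b then 1ℚ else 0ℚ) * Ntℕ r i (j ℕ.+ P) V) (≡ᵇ-true {j ℕ.+ P} refl) ⟩
    1ℚ * Ntℕ r i (j ℕ.+ P) V
  ≡⟨ *-identityˡ _ ⟩
    Ntℕ r i (j ℕ.+ P) V
  ≡⟨ if-true (<ᵇ-true j+P<r′) ⟩
    (if V ≡ᵇ (i ℕ.+ (j ℕ.+ P)) then 1ℚ else 0ℚ)
  ≡⟨ cong (λ x → if V ≡ᵇ x then 1ℚ else 0ℚ) (ℕP.+-assoc i j P) ⟨
    XBlock r (r ∸ i ∸ j) (i ℕ.+ j) p v ∎
  where
  open ≡-Reasoning
  r′ = r ∸ i
  P = toℕ p
  V = toℕ v
  h : ℕ → ℚ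
  h w = (if w ≡ᵇ (j ℕ.+ P) then 1ℚ else 0ℚ) * Ntℕ r i w V
  -- p : Fin (r′ ∸ j) is only inhabited when j < r′.
  j+P<r′ : j ℕ.+ P < r′
  j+P<r′ with j ℕP.≤? r′
  ... | yes j≤r′ = subst (j ℕ.+ P <_) (ℕP.m+[n∸m]≡n j≤r′) (ℕP.+-monoʳ-< j (FinP.toℕ<n p))
  ... | no j≰r′  = ⊥-elim (FinP.¬Fin0 (subst Fin (ℕP.m≤n⇒m∸n≡0 (ℕP.≤-trans (ℕP.n≤1+n r′) (ℕP.≰⇒> j≰r′))) p))

negYSums·Sw : ∀ r d (p : Fin d) (v : Fin (r ℕ.+ r)) → d ≤ r → (negYSums r d · Sw r) p v ≡ XBlock r d (r ∸ d) p v
negYSums·Sw r d p v d≤r = begin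
    sumOver (allFin (r ℕ.+ r)) (h ∘ toℕ)
  ≡⟨ sum-allFin (r ℕ.+ r) h ⟩
    sumOver (upTo (r ℕ.+ r)) h
  ≡⟨ sum-upTo-window (r ℕ.+ r) r (suc L) h (ℕP.+-monoʳ-≤ r 1+L≤r) outside ⟩
    sumOver (upTo (suc L)) (λ q → h (r ℕ.+ q))
  ≡⟨ sum-cong (upTo (suc L)) (λ q q∈ → inside q (∈P.∈-upTo⁻ q∈)) ⟩
    sumOver (upTo (suc L)) (λ q → - 1ℚ * SwYℕ r V q)
  ≡⟨ *-distribˡ-sum (upTo (suc L)) (- 1ℚ) (SwYℕ r V) ⟨
    - 1ℚ * sumOver (upTo (suc L)) (SwYℕ r V)
  ≡⟨ cong (- 1ℚ *_) (sum-SwYℕ r V L) ⟩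
    - 1ℚ * (- indicator (V ≡ᵇ (r ∸ suc L)))
  ≡⟨ -1*-indicator (V ≡ᵇ (r ∸ suc L)) ⟩
    indicator (V ≡ᵇ (r ∸ suc L))
  ≡⟨ cong (λ x → indicator (V ≡ᵇ x)) r∸[1+L]≡ ⟩
    XBlock r d (r ∸ d) p v ∎
  where
  open ≡-Reasoning
  P = toℕ p
  V = toℕ v
  L = d ∸ suc P
  1+L≡ : suc L ≡ d ∸ P
  1+L≡ = sym (ℕP.+-∸-assoc 1 (FinP.toℕ<n p))
  1+L≤r : suc L ≤ r
  1+L≤r = subst (_≤ r) (sym 1+L≡) (ℕP.≤-trans (ℕP.m∸n≤m d P) d≤r)
  h : ℕ → ℚ
  h w = (if (r ≤ᵇ w) ∧ ((w ∸ r) <ᵇ (d ∸ P)) then - 1ℚ else 0ℚ) * Swℕ r w V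
  outside : ∀ w → w < r ℕ.+ r → w < r ⊎ r ℕ.+ suc L ≤ w → h w ≡ 0ℚ
  outside w _ (inj₁ w<r)     = ifMinusOne-false-* _ (Swℕ r w V) (cong (_∧ ((w ∸ r) <ᵇ (d ∸ P))) (≤ᵇ-false (ℕP.<⇒≱ w<r)))
  outside w _ (inj₂ r+1+L≤w) = ifMinusOne-false-* _ (Swℕ r w V)
    (trans (cong ((r ≤ᵇ w) ∧_) (<ᵇ-false (ℕP.≤⇒≯ (subst (_≤ w ∸ r) 1+L≡
              (ℕP.≤-trans (ℕP.≤-reflexive (sym (ℕP.m+n∸m≡n r (suc L)))) (ℕP.∸-monoˡ-≤ r r+1+L≤w))))))
           (∧-zeroʳ _))
  inside : ∀ q → q < suc L → h (r ℕ.+ q) ≡ - 1ℚ * SwYℕ r V q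
  inside q q<1+L rewrite ≤ᵇ-true (ℕP.m≤m+n r q) | ℕP.m+n∸m≡n r q | <ᵇ-true (subst (q <_) 1+L≡ q<1+L)
                       | <ᵇ-false (ℕP.≤⇒≯ (ℕP.m≤m+n r q)) = refl
  -1*-indicator : ∀ b → - 1ℚ * (- indicator b) ≡ indicator b
  -1*-indicator true  = refl
  -1*-indicator false = refl
  r∸[1+L]≡ : r ∸ suc L ≡ (r ∸ d) ℕ.+ P
  r∸[1+L]≡ = trans (cong (r ∸_) 1+L≡) (trans (cong (_∸ (d ∸ P)) (sym r≡)) (ℕP.m+n∸n≡m _ (d ∸ P)))
    where
    r≡ : ((r ∸ d) ℕ.+ P) ℕ.+ (d ∸ P) ≡ r
    r≡ = trans (ℕP.+-assoc (r ∸ d) P (d ∸ P)) (trans (cong ((r ∸ d) ℕ.+_) (ℕP.m+[n∸m]≡n (ℕP.<⇒≤ (FinP.toℕ<n p)))) (ℕP.m∸n+n≡m d≤r))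

XBlock·Sw : ∀ r d t (p : Fin d) (v : Fin (r ℕ.+ r)) → t ℕ.+ d ≡ r → (XBlock r d t · Sw r) p v ≡ negYSums r d p v
XBlock·Sw r d t p v t+d≡r = begin
    sumOver (allFin (r ℕ.+ r)) (h ∘ toℕ)
  ≡⟨ sum-allFin (r ℕ.+ r) h ⟩
    sumOver (upTo (r ℕ.+ r)) h
  ≡⟨ sum-upTo-single (r ℕ.+ r) (t ℕ.+ P) h (ℕP.<-≤-trans t+P<r (ℕP.m≤m+n r r)) (λ w _ w≢ → ifOne-false-* _ (Swℕ r w V) (≡ᵇ-false w≢)) ⟩
    h (t ℕ.+ P)
  ≡⟨ cong (λ b → (if b then 1ℚ else 0ℚ) * Swℕ r (t ℕ.+ P) V) (≡ᵇ-true {t ℕ.+ P} refl) ⟩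
    1ℚ * Swℕ r (t ℕ.+ P) V
  ≡⟨ *-identityˡ _ ⟩
    Swℕ r (t ℕ.+ P) V
  ≡⟨ if-true (<ᵇ-true t+P<r) ⟩
    (if (r ≤ᵇ V) ∧ ((V ∸ r) <ᵇ (r ∸ (t ℕ.+ P))) then - 1ℚ else 0ℚ)
  ≡⟨ cong (λ x → if (r ≤ᵇ V) ∧ ((V ∸ r) <ᵇ x) then - 1ℚ else 0ℚ)
          (trans (cong (_∸ (t ℕ.+ P)) (sym t+d≡r)) (ℕP.[m+n]∸[m+o]≡n∸o t d P)) ⟩
    negYSums r d p v ∎
  where
  open ≡-Reasoning
  P = toℕ p
  V = toℕ v
  h : ℕ → ℚ
  h w = (if w ≡ᵇ (t ℕ.+ P) then 1ℚ else 0ℚ) * Swℕ r w V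
  t+P<r : t ℕ.+ P < r
  t+P<r = subst (t ℕ.+ P <_) t+d≡r (ℕP.+-monoʳ-< t (FinP.toℕ<n p))

sumTriple : ℕ → (ℕ → ℕ → ℕ → ℚ) → ℚ
sumTriple R G = sumOver (upTo (suc R)) (λ j → sumOver (upTo (suc j)) (λ k → G k (j ∸ k) (R ∸ j)))

sumTriple-cong : ∀ R {G G′ : ℕ → ℕ → ℕ → ℚ} → (∀ k a b → a ≤ R → b ≤ R → G k a b ≡ G′ k a b) →
  sumTriple R G ≡ sumTriple R G′
sumTriple-cong R G≡G′ = sum-cong (upTo (suc R)) (λ j j∈ → sum-cong (upTo (suc j)) (λ k k∈ →
  G≡G′ k (j ∸ k) (R ∸ j) (ℕP.≤-trans (ℕP.m∸n≤m j k) (∈-upTo⇒≤ j∈)) (ℕP.m∸n≤m R j)))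

sumTriple-swap : ∀ R (G : ℕ → ℕ → ℕ → ℚ) → sumTriple R G ≡ sumTriple R (λ k a b → G k b a)
sumTriple-swap R G = begin
    sumOver (upTo (suc R)) (λ j → sumOver (upTo (suc j)) (λ k → G k (j ∸ k) (R ∸ j)))
  ≡⟨ sum-pairs (upTo (suc R)) (λ j → upTo (suc j)) f ⟨
    sumOver Δ f
  ≡⟨ sum-reindex (ProdP.≡-dec ℕP._≟_ ℕP._≟_) Δ Δ ψ ψ f Δ-unique Δ-unique ψΔ ψΔ ψψ ψψ ⟨
    sumOver Δ (f ∘ ψ)
  ≡⟨ sum-pairs (upTo (suc R)) (λ j → upTo (suc j)) (f ∘ ψ) ⟩
    sumOver (upTo (suc R)) (λ j → sumOver (upTo (suc j)) (λ k → f (ψ (j , k))))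
  ≡⟨ sum-cong (upTo (suc R)) (λ j j∈ → sum-cong (upTo (suc j)) (λ k k∈ →
       cong₂ (G k) (ℕP.m+n∸n≡m (R ∸ j) k) (key (∈-upTo⇒≤ j∈) (∈-upTo⇒≤ k∈)))) ⟩
    sumOver (upTo (suc R)) (λ j → sumOver (upTo (suc j)) (λ k → G k (R ∸ j) (j ∸ k))) ∎
  where
  open ≡-Reasoning
  Δ = pairs (upTo (suc R)) (λ j → upTo (suc j))
  Δ-unique = pairs-unique (upTo (suc R)) (λ j → upTo (suc j)) (upTo-unique (suc R)) (λ j → upTo-unique (suc j))
  f : ℕ × ℕ → ℚ
  f (j , k) = G k (j ∸ k) (R ∸ j)
  -- (j, k) ↦ (R - j + k, k) exchanges the roles of a = j - k and b = R - j.
  ψ : ℕ × ℕ → ℕ × ℕ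
  ψ (j , k) = (R ∸ j) ℕ.+ k , k
  bounds : ∀ {j k} → (j , k) ∈ Δ → j ≤ R × k ≤ j
  bounds p∈ = let (j∈ , k∈) = ∈-pairs⁻ (upTo (suc R)) (λ j → upTo (suc j)) p∈ in ∈-upTo⇒≤ j∈ , ∈-upTo⇒≤ k∈
  key : ∀ {j k} → j ≤ R → k ≤ j → R ∸ ((R ∸ j) ℕ.+ k) ≡ j ∸ k
  key {j} {k} j≤R k≤j = trans (sym (ℕP.∸-+-assoc R (R ∸ j) k)) (cong (_∸ k) (ℕP.m∸[m∸n]≡n j≤R))
  ψΔ : ∀ {p} → p ∈ Δ → ψ p ∈ Δ
  ψΔ {j , k} p∈ = let (j≤R , k≤j) = bounds p∈ in
    ∈-pairs⁺ (upTo (suc R)) (λ j → upTo (suc j))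
      (∈P.∈-upTo⁺ (s≤s (ℕP.≤-trans (ℕP.+-monoʳ-≤ (R ∸ j) k≤j) (ℕP.≤-reflexive (ℕP.m∸n+n≡m j≤R)))))
      (∈P.∈-upTo⁺ (s≤s (ℕP.m≤n+m k (R ∸ j))))
  ψψ : ∀ {p} → p ∈ Δ → ψ (ψ p) ≡ p
  ψψ {j , k} p∈ = let (j≤R , k≤j) = bounds p∈ in
    cong (_, k) (trans (cong (ℕ._+ k) (key j≤R k≤j)) (ℕP.m∸n+n≡m k≤j))

linSubst-sumTriple : ∀ {m n} R (G : ℕ → ℕ → ℕ → Series m) (M : Fin m → Fin n → ℚ) →
  linSubst (λ e → sumTriple R (λ k a b → G k a b e)) M ≐ (λ e → sumTriple R (λ k a b → linSubst (G k a b) M e))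
linSubst-sumTriple R G M e =
  trans (linSubst-sum (upTo (suc R)) (λ j e′ → sumOver (upTo (suc j)) (λ k → G k (j ∸ k) (R ∸ j) e′)) M e)
        (sum-cong (upTo (suc R)) (λ j _ → linSubst-sum (upTo (suc j)) (λ k → G k (j ∸ k) (R ∸ j)) M e))

-- The expansion of b̃

module _ (β : Mould) (r : ℕ) where

  coeff : ℕ → ℚ
  coeff i = sign i * recip (2 ^ i ℕ.* i !)

  βterm : ℕ → ℕ → Series (r ℕ.+ r)
  βterm a b = linSubst (βser β a) (negYSums r a) ⊗ linSubst (βser β b) (XBlock r b (r ∸ b))

  btSum : (ℕ → ℕ → Series (r ℕ.+ r)) → Series (r ℕ.+ r)
  btSum T e = sumOver (upTo (suc r)) (λ i → coeff i * sumTriple (r ∸ i) (λ k a b → γ β k * T a b e))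

  βterm-Sw : ∀ a b → a ≤ r → b ≤ r → linSubst (βterm a b) (Sw r) ≐ βterm b a
  βterm-Sw a b a≤r b≤r = begin
    linSubst (βterm a b) (Sw r)
      ≈⟨ linSubst-⊗ (linSubst (βser β a) (negYSums r a)) (linSubst (βser β b) (XBlock r b (r ∸ b))) (Sw r) ⟩
    linSubst (linSubst (βser β a) (negYSums r a)) (Sw r) ⊗ linSubst (linSubst (βser β b) (XBlock r b (r ∸ b))) (Sw r)
      ≈⟨ ⊗-cong (≐-trans (linSubst-∘ (βser β a) (negYSums r a) (Sw r))
                         (linSubst-congʳ (βser β a) (λ p v → negYSums·Sw r a p v a≤r)))
                (≐-trans (linSubst-∘ (βser β b) (XBlock r b (r ∸ b)) (Sw r))
                         (linSubst-congʳ (βser β b) (λ p v → XBlock·Sw r b (r ∸ b) p v (ℕP.m∸n+n≡m b≤r)))) ⟩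
    linSubst (βser β a) (XBlock r a (r ∸ a)) ⊗ linSubst (βser β b) (negYSums r b)
      ≈⟨ ⊗-comm (linSubst (βser β a) (XBlock r a (r ∸ a))) (linSubst (βser β b) (negYSums r b)) ⟩
    βterm b a ∎
    where open ≐-Reasoning

  bb-Nt : ∀ i → i ≤ r → linSubst (bb β (r ∸ i)) (Nt r i) ≐ (λ e → sumTriple (r ∸ i) (λ k a b → γ β k * βterm a b e))
  bb-Nt i i≤r e =
    trans (linSubst-sum (upTo (suc r′)) (λ j e′ → sumOver (upTo (suc j)) (λ k → γ β k * (βY j k ⊗ βX j) e′)) (Nt r i) e)
      (sum-cong (upTo (suc r′)) (λ j j∈ →
        trans (linSubst-sum (upTo (suc j)) (λ k e′ → γ β k * (βY j k ⊗ βX j) e′) (Nt r i) e)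
              (sum-cong (upTo (suc j)) (λ k k∈ → trans (linSubst-scale (γ β k) (βY j k ⊗ βX j) (Nt r i) e)
                                                       (cong (γ β k *_) (term (∈-upTo⇒≤ j∈) (∈-upTo⇒≤ k∈) e))))))
    where
    r′ = r ∸ i
    βY : ℕ → ℕ → Series (r′ ℕ.+ r′)
    βY j k = linSubst (βser β (j ∸ k)) (MY r′ j k)
    βX : ℕ → Series (r′ ℕ.+ r′)
    βX j = linSubst (βser β (r′ ∸ j)) (MX r′ j)
    i+j≡ : ∀ {j} → j ≤ r′ → i ℕ.+ j ≡ r ∸ (r′ ∸ j)
    i+j≡ {j} j≤r′ = sym (trans (cong (_∸ (r′ ∸ j)) (sym r≡)) (ℕP.m+n∸n≡m (i ℕ.+ j) (r′ ∸ j)))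
      where
      r≡ : (i ℕ.+ j) ℕ.+ (r′ ∸ j) ≡ r
      r≡ = trans (ℕP.+-assoc i j _) (trans (cong (i ℕ.+_) (ℕP.m+[n∸m]≡n j≤r′)) (ℕP.m+[n∸m]≡n i≤r))
    term : ∀ {j k} → j ≤ r′ → k ≤ j → linSubst (βY j k ⊗ βX j) (Nt r i) ≐ βterm (j ∸ k) (r′ ∸ j)
    term {j} {k} j≤r′ k≤j = ≐-trans (linSubst-⊗ (βY j k) (βX j) (Nt r i))
      (⊗-cong (≐-trans (linSubst-∘ (βser β (j ∸ k)) (MY r′ j k) (Nt r i))
                       (linSubst-congʳ (βser β (j ∸ k)) (λ p v → MY·Nt r i j k p v j≤r′ k≤j)))
              (≐-trans (linSubst-∘ (βser β (r′ ∸ j)) (MX r′ j) (Nt r i))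
                       (linSubst-congʳ (βser β (r′ ∸ j)) (λ p v → trans (MX·Nt r i j p v)
                                                          (cong (λ t → XBlock r (r′ ∸ j) t p v) (i+j≡ j≤r′))))))

  bt-expansion : bt β r ≐ btSum βterm
  bt-expansion e = sum-cong (upTo (suc r)) (λ i i∈ → cong (coeff i *_) (bb-Nt i (∈-upTo⇒≤ i∈) e))

  bt-Sw-expansion : linSubst (bt β r) (Sw r) ≐ btSum (λ a b → βterm b a)
  bt-Sw-expansion e =
    trans (linSubst-sum (upTo (suc r)) (λ i e′ → coeff i * linSubst (bb β (r ∸ i)) (Nt r i) e′) (Sw r) e)
      (sum-cong (upTo (suc r)) (λ i i∈ → begin
          linSubst (λ e′ → coeff i * linSubst (bb β (r ∸ i)) (Nt r i) e′) (Sw r) e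
        ≡⟨ linSubst-scale (coeff i) (linSubst (bb β (r ∸ i)) (Nt r i)) (Sw r) e ⟩
          coeff i * linSubst (linSubst (bb β (r ∸ i)) (Nt r i)) (Sw r) e
        ≡⟨ cong (coeff i *_) (linSubst-congˡ (Sw r) (bb-Nt i (∈-upTo⇒≤ i∈)) e) ⟩
          coeff i * linSubst (λ e′ → sumTriple (r ∸ i) (λ k a b → γ β k * βterm a b e′)) (Sw r) e
        ≡⟨ cong (coeff i *_) (linSubst-sumTriple (r ∸ i) (λ k a b e′ → γ β k * βterm a b e′) (Sw r) e) ⟩
          coeff i * sumTriple (r ∸ i) (λ k a b → linSubst (λ e′ → γ β k * βterm a b e′) (Sw r) e)
        ≡⟨ cong (coeff i *_) (sumTriple-cong (r ∸ i) (λ k a b a≤ b≤ →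
             trans (linSubst-scale (γ β k) (βterm a b) (Sw r) e)
                   (cong (γ β k *_) (βterm-Sw a b (ℕP.≤-trans a≤ (ℕP.m∸n≤m r i)) (ℕP.≤-trans b≤ (ℕP.m∸n≤m r i)) e)))) ⟩
          coeff i * sumTriple (r ∸ i) (λ k a b → γ β k * βterm b a e) ∎))
    where open ≡-Reasoning

  btSum-swap : (T : ℕ → ℕ → Series (r ℕ.+ r)) → btSum T ≐ btSum (λ a b → T b a)
  btSum-swap T e = sum-cong (upTo (suc r)) (λ i _ → cong (coeff i *_) (sumTriple-swap (r ∸ i) (λ k a b → γ β k * T a b e)))

lemma6p24 : (β : Mould) → IsBeta β → (r : ℕ) → 1 ≤ r →
    (e : Vec ℕ (r ℕ.+ r)) → bt β r e ≡ linSubst (bt β r) (Sw r) e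
lemma6p24 β _ r _ e = begin
  bt β r e                               ≡⟨ bt-expansion β r e ⟩
  btSum β r (βterm β r) e                ≡⟨ btSum-swap β r (βterm β r) e ⟩
  btSum β r (λ a b → βterm β r b a) e    ≡⟨ bt-Sw-expansion β r e ⟨
  linSubst (bt β r) (Sw r) e             ∎
  where open ≡-Reasoning
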